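{- Let $A\in\operatorname{M}_n(\mathbb{Z})$ be non-singular. (1) If $\mathcal{P}=\emptyset$, equivalently $A\in\operatorname{GL}_n(\mathbb{Z})$, then $\operatorname{End}(G_A)=\operatorname{M}_n(\mathbb{Z})$. (2) If $\mathcal{P}'=\emptyset$ and $A\notin\operatorname{GL}_n(\mathbb{Z})$, then $\operatorname{End}(G_A)=\operatorname{M}_n(\mathcal{R})$.
   Context: $G_A=\{A^k\mathbf{x}\mid\mathbf{x}\in\mathbb{Z}^n,k\in\mathbb{Z}\}\subseteq\mathbb{Q}^n$; every group endomorphism of $G_A$ is given by a matrix in $\operatorname{M}_n(\mathbb{Q})$, and $\operatorname{End}(G_A)$ is identified with $\{T\in\operatorname{M}_n(\mathbb{Q})\mid T(G_A)\subseteq G_A\}$. $\mathcal{R}=\mathbb{Z}[1/\det A]$; $\mathcal{P}$ is the set of primes dividing $\det A$; $\mathcal{P}'=\{p\in\mathcal{P}\mid h_A\not\equiv x^n\pmod p\}$ with $h_A$ the characteristic polynomial of $A$. -}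

module Defs where

open import Level using (0ℓ)
open import Data.Nat as ℕ using (ℕ; zero; suc)
open import Data.Nat.Primality using (Prime)
open import Data.Nat.Divisibility using () renaming (_∣_ to _∣ℕ_)
open import Data.Integer as ℤ using (ℤ; +_; -[1+_])
open import Data.Integer.Divisibility as ℤD using ()
open import Data.Rational as ℚ using (ℚ)
open import Data.Fin as Fin using (Fin; zero; suc; punchIn; toℕ)
open import Data.Fin.Properties using (_≟_)
open import Data.List using (List; []; _∷_; map)
open import Data.Bool using (Bool; true; false; if_then_else_)
open import Data.Product using (Σ; ∃; _×_; _,_)
open import Relation.Nullary using (¬_)
open import Relation.Nullary.Decidable using (⌊_⌋)
open import Relation.Binary.PropositionalEquality using (_≡_)
open import Algebra.Bundles.Raw using (RawRing)

Mat : Set → ℕ → Set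
Mat R n = Fin n → Fin n → R

Vecℚ : ℕ → Set
Vecℚ n = Fin n → ℚ

module _ (R : RawRing 0ℓ 0ℓ) where
  open RawRing R

  sumFin : ∀ {n} → (Fin n → Carrier) → Carrier
  sumFin {zero}  f = 0#
  sumFin {suc n} f = f zero + sumFin (λ i → f (suc i))

  signed : ℕ → Carrier → Carrier
  signed zero    x = x
  signed (suc k) x = - signed k x

  minor : ∀ {n} → Mat Carrier (suc n) → Fin (suc n) → Mat Carrier n
  minor M j i k = M (suc i) (punchIn j k)

  det : ∀ {n} → Mat Carrier n → Carrier
  det {zero}  M = 1#
  det {suc n} M = sumFin (λ j → signed (toℕ j) (M zero j * det (minor M j)))

-- Integer polynomials as coefficient lists (lowest degree first)

Poly : Set
Poly = List ℤ

addP : Poly → Poly → Poly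
addP []       q        = q
addP (a ∷ p)  []       = a ∷ p
addP (a ∷ p)  (b ∷ q)  = (a ℤ.+ b) ∷ addP p q

mulP : Poly → Poly → Poly
mulP []      q = []
mulP (a ∷ p) q = addP (map (a ℤ.*_) q) (+ 0 ∷ mulP p q)

coeff : Poly → ℕ → ℤ
coeff []      _       = + 0
coeff (a ∷ p) zero    = a
coeff (a ∷ p) (suc i) = coeff p i

polyRawRing : RawRing 0ℓ 0ℓ
polyRawRing = record
  { Carrier = Poly
  ; _≈_     = λ p q → ∀ i → coeff p i ≡ coeff q i
  ; _+_     = addP
  ; _*_     = mulP
  ; -_      = map (λ a → ℤ.- a)
  ; 0#      = []
  ; 1#      = + 1 ∷ []
  }

detℤ : ∀ {n} → Mat ℤ n → ℤ
detℤ = det ℤ.+-*-rawRing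

-- characteristic polynomial h_A = det (x·I − A)
charPoly : ∀ {n} → Mat ℤ n → Poly
charPoly A = det polyRawRing
  (λ i j → if ⌊ i ≟ j ⌋ then (ℤ.- A i j) ∷ + 1 ∷ [] else (ℤ.- A i j) ∷ [])

-- coefficients of the monomial x^n
xPow : ℕ → ℕ → ℤ
xPow n i = if ⌊ i ℕ.≟ n ⌋ then + 1 else + 0

CongXPowMod : Poly → ℕ → ℕ → Set
CongXPowMod h n p = ∀ i → (+ p) ℤD.∣ (coeff h i ℤ.- xPow n i)

InP : ∀ {n} → Mat ℤ n → ℕ → Set
InP A p = Prime p × (p ∣ℕ ℤ.∣ detℤ A ∣)

InP' : ∀ {n} → Mat ℤ n → ℕ → Set
InP' {n} A p = InP A p × ¬ CongXPowMod (charPoly A) n p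

𝒫-empty : ∀ {n} → Mat ℤ n → Set
𝒫-empty A = ∀ p → ¬ InP A p

𝒫'-empty : ∀ {n} → Mat ℤ n → Set
𝒫'-empty A = ∀ p → ¬ InP' A p

InGLℤ : ∀ {n} → Mat ℤ n → Set
InGLℤ A = ℤ.∣ detℤ A ∣ ≡ 1

toℚ : ℤ → ℚ
toℚ z = z ℚ./ 1

mulVec : ∀ {n} → Mat ℚ n → Vecℚ n → Vecℚ n
mulVec M x i = sumFin ℚ.+-*-rawRing (λ j → M i j ℚ.* x j)

powAct : ∀ {n} → Mat ℤ n → ℕ → Vecℚ n → Vecℚ n
powAct A zero    x = x
powAct A (suc m) x = mulVec (λ i j → toℚ (A i j)) (powAct A m x)

_≋_ : ∀ {n} → Vecℚ n → Vecℚ n → Set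
x ≋ y = ∀ i → x i ≡ y i

-- "x = A^k y" for k ∈ ℤ (A non-singular): for k = -(m+1) this is
-- unfolded as A^(m+1) x = y.
IsPow : ∀ {n} → Mat ℤ n → ℤ → Vecℚ n → Vecℚ n → Set
IsPow A (+ m)     y x = x ≋ powAct A m y
IsPow A -[1+ m ]  y x = powAct A (suc m) x ≋ y

-- x ∈ G_A = { A^k y | y ∈ ℤ^n, k ∈ ℤ }
InGA : ∀ {n} → Mat ℤ n → Vecℚ n → Set
InGA {n} A x = Σ ℤ λ k → Σ (Fin n → ℤ) λ y → IsPow A k (λ i → toℚ (y i)) x

InEnd : ∀ {n} → Mat ℤ n → Mat ℚ n → Set
InEnd A T = ∀ x → InGA A x → InGA A (mulVec T x)

-- Subrings ℤ ⊆ ℛ = ℤ[1/d] ⊆ ℚ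

IsInt : ℚ → Set
IsInt q = ∃ λ z → q ≡ toℚ z

powℚ : ℚ → ℕ → ℚ
powℚ q zero    = ℚ.1ℚ
powℚ q (suc m) = q ℚ.* powℚ q m

InZinv : ℤ → ℚ → Set
InZinv d q = ∃ λ m → ∃ λ z → q ℚ.* powℚ (toℚ d) m ≡ toℚ z

InMℤ : ∀ {n} → Mat ℚ n → Set
InMℤ T = ∀ i j → IsInt (T i j)

InMR : ∀ {n} → ℤ → Mat ℚ n → Set
InMR d T = ∀ i j → InZinv d (T i j)

-- Cayley–Hamilton, proved by comparing coefficients in (x·1 − A)·adj (x·1 − A) = h_A·1 over ℤ[x],
-- gives h_A(A) = 0 with h_A(0) = ±d, where d = det A; hence Q·A = d·1 for an integer matrix Q.
-- So Aᵏx ∈ ℤⁿ forces dᵏx ∈ ℤⁿ, i.e. G_A ⊆ ℤ[1/d]ⁿ, and as G_A contains the standard basis,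
-- End(G_A) ⊆ M_n(ℤ[1/d]). Conversely, if h_A ≡ xⁿ (mod p) then Aⁿ = p·N with N integral, so Aⁿ
-- removes a factor p from the denominators of a vector; running through the prime factors of d
-- gives ℤ[1/d]ⁿ ⊆ G_A. Thus G_A = ℤ[1/d]ⁿ and End(G_A) = M_n(ℤ[1/d]). If 𝒫 = ∅, the condition on
-- primes is vacuous and d = ±1, so ℤ[1/d] = ℤ.

module Submission where

open import Defs
open import Level using (0ℓ)
open import Algebra.Bundles using (CommutativeRing; AbelianGroup; Ring)
open import Data.Nat using (ℕ)
open import Data.Integer using (ℤ; +_)
open import Data.Rational using (ℚ)
open import Data.Product using (_×_; _,_)
open import Function.Bundles using (_⇔_)
open import Function.Construct.Composition using (_⇔-∘_)
open import Relation.Nullary using (¬_)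
open import Relation.Binary.PropositionalEquality using (_≢_)

module FinIndex where

  open import Data.Nat using (ℕ; zero; suc; _+_; _≤_; _⊔_)
  open import Data.Nat.Properties using (+-suc; +-identityʳ; +-comm; ≤-trans; m≤m⊔n; m≤n⊔m)
  open import Data.Product using (∃-syntax; _,_)
  open import Data.Fin using (Fin; zero; suc; punchIn; pinch; toℕ)
  open import Data.Sum using (_⊎_; inj₁; inj₂)
  open import Relation.Binary.PropositionalEquality using (_≡_; refl; cong; sym; trans)

  upperBound : ∀ {n} (f : Fin n → ℕ) → ∃[ D ] (∀ i → f i ≤ D)
  upperBound {zero}  f = 0 , λ ()
  upperBound {suc n} f with upperBound (λ i → f (suc i))
  ... | D , f≤D = f zero ⊔ D , λ { zero → m≤m⊔n (f zero) D ; (suc i) → ≤-trans (f≤D i) (m≤n⊔m (f zero) D) }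

  -- A total punchOut: the value of punchOut′ a a is irrelevant.
  punchOut′ : ∀ {n} → Fin (suc (suc n)) → Fin (suc (suc n)) → Fin (suc n)
  punchOut′ zero            zero    = zero
  punchOut′ zero            (suc c) = c
  punchOut′ (suc a)         zero    = zero
  punchOut′ {zero}  (suc a) (suc c) = zero
  punchOut′ {suc n} (suc a) (suc c) = suc (punchOut′ a c)

  punchOut′-punchIn : ∀ {n} (a : Fin (suc (suc n))) b → punchOut′ a (punchIn a b) ≡ b
  punchOut′-punchIn zero            b       = refl
  punchOut′-punchIn (suc a)         zero    = refl
  punchOut′-punchIn {suc n} (suc a) (suc b) = cong suc (punchOut′-punchIn a b)

  punchOut′-punchIn-pinch : ∀ {n} (c : Fin (suc (suc n))) d → punchOut′ (punchIn c d) c ≡ pinch d c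
  punchOut′-punchIn-pinch zero            d       = refl
  punchOut′-punchIn-pinch (suc c)         zero    = refl
  punchOut′-punchIn-pinch {suc n} (suc c) (suc d) = cong suc (punchOut′-punchIn-pinch c d)

  punchIn-pinch-swap : ∀ {n} (c : Fin (suc (suc n))) (d : Fin (suc n)) (k : Fin n) →
    punchIn (punchIn c d) (punchIn (pinch d c) k) ≡ punchIn c (punchIn d k)
  punchIn-pinch-swap zero    d       k       = refl
  punchIn-pinch-swap (suc c) zero    k       = refl
  punchIn-pinch-swap (suc c) (suc d) zero    = refl
  punchIn-pinch-swap (suc c) (suc d) (suc k) = cong suc (punchIn-pinch-swap c d k)

  -- Exactly one of the two moves its argument: punchIn c d raises d, or pinch d c lowers c.
  punchIn-pinch-parity : ∀ {n} (c : Fin (suc (suc n))) (d : Fin (suc n)) →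
    suc (toℕ c + toℕ d) ≡ toℕ (punchIn c d) + toℕ (pinch d c) ⊎
    suc (toℕ c + toℕ d) ≡ toℕ (punchIn c d) + toℕ (pinch d c) + 2
  punchIn-pinch-parity zero            d    = inj₁ (sym (+-identityʳ _))
  punchIn-pinch-parity (suc c)         zero = inj₂ (trans (cong (λ z → suc (suc z)) (+-identityʳ (toℕ c))) (+-comm 2 (toℕ c)))
  punchIn-pinch-parity {suc n} (suc c) (suc d) with punchIn-pinch-parity c d
  ... | inj₁ e = inj₁ (cong suc (trans (cong suc (+-suc (toℕ c) (toℕ d))) (trans (cong suc e) (sym (+-suc (toℕ (punchIn c d)) _)))))
  ... | inj₂ e = inj₂ (cong suc (trans (cong suc (+-suc (toℕ c) (toℕ d))) (trans (cong suc e) (cong (_+ 2) (sym (+-suc (toℕ (punchIn c d)) _))))))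

module Determinant (R : CommutativeRing 0ℓ 0ℓ) where

  open import Data.Nat as ℕ using (ℕ; zero; suc)
  import Data.Nat.Properties as ℕP
  open import Data.Fin using (Fin; zero; suc; punchIn; pinch; toℕ)
  open import Data.Fin.Properties using (punchInᵢ≢i)
  open import Data.Vec.Functional using (updateAt)
  open import Data.Vec.Functional.Properties using (updateAt-updates; updateAt-minimal)
  open import Data.Sum using (_⊎_; inj₁; inj₂)
  open import Data.Empty using (⊥-elim)
  open import Relation.Binary.PropositionalEquality as ≡ using (_≡_; _≢_)
  open import Algebra.Bundles.Raw using (RawRing)
  open import Data.Nat.Tactic.RingSolver using (solve-∀)
  open CommutativeRing R hiding (zero)
  open import Algebra.Properties.Ring ring using (-‿distribˡ-*; -‿distribʳ-*; -‿involutive; -0#≈0#; -‿+-comm; +-cancelʳ)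
  open import Algebra.Properties.CommutativeMonoid.Sum +-commutativeMonoid
    using (sum; sum-cong-≋; sum-replicate-zero; sum-remove; ∑-distrib-+; ∑-comm)
  open import Algebra.Properties.Semiring.Sum semiring using (*-distribˡ-sum)
  open import Algebra.Properties.CommutativeSemigroup *-commutativeSemigroup using (x∙yz≈y∙xz)
  open import Relation.Binary.Reasoning.Setoid setoid
  open FinIndex

  Det : ∀ {n} → Mat Carrier n → Carrier
  Det = det rawRing

  infix 8 ±[_]_
  ±[_]_ : ℕ → Carrier → Carrier
  ±[_]_ = signed rawRing

  sumFin≡sum : ∀ {n} (f : Fin n → Carrier) → sumFin rawRing f ≡ sum f
  sumFin≡sum {zero}  f = ≡.refl
  sumFin≡sum {suc n} f = ≡.cong (λ s → f zero + s) (sumFin≡sum (λ i → f (suc i)))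

  -‿sum : ∀ {n} (f : Fin n → Carrier) → - sum f ≈ sum (λ i → - f i)
  -‿sum {zero}  f = -0#≈0#
  -‿sum {suc n} f = trans (sym (-‿+-comm _ _)) (+-congˡ (-‿sum (λ i → f (suc i))))

  sum-offDiagonal : ∀ {n} (g : Fin (suc n) → Fin (suc n) → Carrier) →
    sum (λ a → sum (λ b → g a (punchIn a b))) ≈ sum (λ c → sum (λ d → g (punchIn c d) c))
  sum-offDiagonal g = +-cancelʳ (sum (λ a → g a a)) _ _ (begin
    sum (λ a → sum (λ b → g a (punchIn a b))) + sum (λ a → g a a) ≈⟨ +-comm _ _ ⟩
    sum (λ a → g a a) + sum (λ a → sum (λ b → g a (punchIn a b))) ≈⟨ ∑-distrib-+ (λ a → g a a) (λ a → sum (λ b → g a (punchIn a b))) ⟨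
    sum (λ a → g a a + sum (λ b → g a (punchIn a b)))               ≈⟨ sum-cong-≋ (λ a → sum-remove {i = a} (g a)) ⟨
    sum (λ a → sum (λ c → g a c))                                   ≈⟨ ∑-comm g ⟩
    sum (λ c → sum (λ a → g a c))                                   ≈⟨ sum-cong-≋ (λ c → sum-remove {i = c} (λ a → g a c)) ⟩
    sum (λ c → g c c + sum (λ d → g (punchIn c d) c))               ≈⟨ ∑-distrib-+ (λ c → g c c) (λ c → sum (λ d → g (punchIn c d) c)) ⟩
    sum (λ c → g c c) + sum (λ c → sum (λ d → g (punchIn c d) c))   ≈⟨ +-comm _ _ ⟩
    sum (λ c → sum (λ d → g (punchIn c d) c)) + sum (λ a → g a a)   ∎)

  ±-cong : ∀ k {x y} → x ≈ y → ±[ k ] x ≈ ±[ k ] y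
  ±-cong zero    e = e
  ±-cong (suc k) e = -‿cong (±-cong k e)

  ±-+ : ∀ k l x → ±[ k ℕ.+ l ] x ≡ ±[ k ] ±[ l ] x
  ±-+ zero    l x = ≡.refl
  ±-+ (suc k) l x = ≡.cong -_ (±-+ k l x)

  ±-comm : ∀ k l x → ±[ k ] ±[ l ] x ≈ ±[ l ] ±[ k ] x
  ±-comm k l x = reflexive (≡.trans (≡.sym (±-+ k l x)) (≡.trans (≡.cong (λ m → ±[ m ] x) (ℕP.+-comm k l)) (±-+ l k x)))

  ±-+2 : ∀ k x → ±[ k ℕ.+ 2 ] x ≈ ±[ k ] x
  ±-+2 k x = trans (reflexive (±-+ k 2 x)) (±-cong k (-‿involutive x))

  ±-*ʳ : ∀ k x y → ±[ k ] (x * y) ≈ x * ±[ k ] y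
  ±-*ʳ zero    x y = refl
  ±-*ʳ (suc k) x y = trans (-‿cong (±-*ʳ k x y)) (-‿distribʳ-* x (±[ k ] y))

  ±-zero : ∀ k → ±[ k ] 0# ≈ 0#
  ±-zero zero    = refl
  ±-zero (suc k) = trans (-‿cong (±-zero k)) -0#≈0#

  ±-sum : ∀ k {n} (f : Fin n → Carrier) → ±[ k ] sum f ≈ sum (λ i → ±[ k ] f i)
  ±-sum zero    f = refl
  ±-sum (suc k) f = trans (-‿cong (±-sum k f)) (-‿sum (λ i → ±[ k ] f i))

  ±-pull : ∀ k l x y → ±[ k ] (x * ±[ l ] y) ≈ ±[ k ℕ.+ l ] (x * y)
  ±-pull k l x y = trans (±-cong k (sym (±-*ʳ l x y))) (reflexive (≡.sym (±-+ k l (x * y))))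

  ±-cases : ∀ k x → ±[ k ] x ≈ x ⊎ ±[ k ] x ≈ - x
  ±-cases zero    x = inj₁ refl
  ±-cases (suc k) x with ±-cases k x
  ... | inj₁ e = inj₂ (-‿cong e)
  ... | inj₂ e = inj₁ (trans (-‿cong e) (-‿involutive x))

  ±-parity : ∀ {k l} x → k ≡ l ⊎ k ≡ l ℕ.+ 2 → ±[ k ] x ≈ ±[ l ] x
  ±-parity x (inj₁ ≡.refl)            = refl
  ±-parity {l = l} x (inj₂ ≡.refl)    = ±-+2 l x

  -- The two ways of deleting a pair of columns (see punchIn-pinch-swap) carry the same sign.
  ±-reindex : ∀ {n} i (c : Fin (suc (suc n))) (d : Fin (suc n)) x →
    ±[ suc (i ℕ.+ toℕ c) ℕ.+ toℕ d ] x ≈ ±[ toℕ (punchIn c d) ℕ.+ (i ℕ.+ toℕ (pinch d c)) ] x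
  ±-reindex i c d x = begin
    ±[ suc (i ℕ.+ toℕ c) ℕ.+ toℕ d ] x       ≡⟨ ≡.cong (λ k → ±[ k ] x) (shuffle₁ i (toℕ c) (toℕ d)) ⟩
    ±[ i ℕ.+ suc (toℕ c ℕ.+ toℕ d) ] x       ≡⟨ ±-+ i _ x ⟩
    ±[ i ] ±[ suc (toℕ c ℕ.+ toℕ d) ] x      ≈⟨ ±-cong i (±-parity x (punchIn-pinch-parity c d)) ⟩
    ±[ i ] ±[ X ℕ.+ Y ] x                    ≡⟨ ±-+ i (X ℕ.+ Y) x ⟨
    ±[ i ℕ.+ (X ℕ.+ Y) ] x                   ≡⟨ ≡.cong (λ k → ±[ k ] x) (shuffle₂ i X Y) ⟩
    ±[ X ℕ.+ (i ℕ.+ Y) ] x                   ∎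
    where
    X = toℕ (punchIn c d)
    Y = toℕ (pinch d c)
    shuffle₁ : ∀ i c d → suc (i ℕ.+ c) ℕ.+ d ≡ i ℕ.+ suc (c ℕ.+ d)
    shuffle₁ = solve-∀
    shuffle₂ : ∀ i x y → i ℕ.+ (x ℕ.+ y) ≡ x ℕ.+ (i ℕ.+ y)
    shuffle₂ = solve-∀

  det-suc : ∀ {n} (M : Mat Carrier (suc n)) →
    Det M ≡ sum (λ j → ±[ toℕ j ] (M zero j * Det (minor rawRing M j)))
  det-suc M = sumFin≡sum (λ j → ±[ toℕ j ] (M zero j * Det (minor rawRing M j)))

  det-cong : ∀ {n} {M N : Mat Carrier n} → (∀ i j → M i j ≈ N i j) → Det M ≈ Det N
  det-cong {zero}  e = refl
  det-cong {suc n} {M} {N} e = begin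
    Det M ≡⟨ det-suc M ⟩
    sum (λ j → ±[ toℕ j ] (M zero j * Det (minor rawRing M j)))
      ≈⟨ sum-cong-≋ (λ j → ±-cong (toℕ j) (*-cong (e zero j) (det-cong (λ i k → e (suc i) (punchIn j k))))) ⟩
    sum (λ j → ±[ toℕ j ] (N zero j * Det (minor rawRing N j))) ≡⟨ det-suc N ⟨
    Det N ∎

  minorAt : ∀ {n} → Fin (suc n) → Fin (suc n) → Mat Carrier (suc n) → Mat Carrier n
  minorAt i j M r k = M (punchIn i r) (punchIn j k)

  cofactor : ∀ {n} → Mat Carrier (suc n) → Fin (suc n) → Fin (suc n) → Carrier
  cofactor M i j = ±[ toℕ i ℕ.+ toℕ j ] Det (minorAt i j M)

  det-expand : ∀ {m} (N : Mat Carrier (suc m)) i → Det N ≈ sum (λ j → N i j * cofactor N i j)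
  det-expand N zero = trans (reflexive (det-suc N)) (sum-cong-≋ (λ j → ±-*ʳ (toℕ j) (N zero j) (Det (minorAt zero j N))))
  det-expand {suc m} N (suc i) = begin
    Det N                                             ≡⟨ det-suc N ⟩
    sum (λ a → ±[ toℕ a ] (N zero a * Det (minor rawRing N a))) ≈⟨ sum-cong-≋ expandMinor ⟩
    sum (λ a → sum (λ b → term a (punchIn a b)))     ≈⟨ sum-offDiagonal term ⟩
    sum (λ c → sum (λ d → term (punchIn c d) c))     ≈⟨ sum-cong-≋ (λ c → sym (expandRow c)) ⟩
    sum (λ c → N (suc i) c * cofactor N (suc i) c)   ∎
    where
    -- the contribution of the entries N 0 a and N (i+1) c, for a ≢ c; b is the position of c once column a is deleted
    term′ : Fin (suc (suc m)) → Fin (suc (suc m)) → Fin (suc m) → Carrier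
    term′ a c b = ±[ toℕ a ℕ.+ (toℕ i ℕ.+ toℕ b) ]
      (N zero a * (N (suc i) c * Det (λ r k → N (suc (punchIn i r)) (punchIn a (punchIn b k)))))

    term : Fin (suc (suc m)) → Fin (suc (suc m)) → Carrier
    term a c = term′ a c (punchOut′ a c)

    expandMinor : ∀ a → ±[ toℕ a ] (N zero a * Det (minor rawRing N a)) ≈ sum (λ b → term a (punchIn a b))
    expandMinor a = begin
      ±[ toℕ a ] (N zero a * Det (minor rawRing N a))  ≈⟨ ±-cong (toℕ a) (*-congˡ (det-expand (minor rawRing N a) i)) ⟩
      ±[ toℕ a ] (N zero a * sum f)                    ≈⟨ ±-cong (toℕ a) (*-distribˡ-sum (N zero a) f) ⟩
      ±[ toℕ a ] sum (λ b → N zero a * f b)            ≈⟨ ±-sum (toℕ a) (λ b → N zero a * f b) ⟩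
      sum (λ b → ±[ toℕ a ] (N zero a * f b))          ≈⟨ sum-cong-≋ reassociate ⟩
      sum (λ b → term a (punchIn a b))                 ∎
      where
      f : Fin (suc m) → Carrier
      f b = N (suc i) (punchIn a b) * cofactor (minor rawRing N a) i b
      reassociate : ∀ b → ±[ toℕ a ] (N zero a * f b) ≈ term a (punchIn a b)
      reassociate b = trans (trans (±-cong (toℕ a) (*-congˡ (sym (±-*ʳ (toℕ i ℕ.+ toℕ b) (N (suc i) (punchIn a b)) minorDet))))
          (±-pull (toℕ a) (toℕ i ℕ.+ toℕ b) (N zero a) (N (suc i) (punchIn a b) * minorDet)))
          (reflexive (≡.cong (term′ a (punchIn a b)) (≡.sym (punchOut′-punchIn a b))))
        where minorDet = Det (minorAt i b (minor rawRing N a))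

    expandRow : ∀ c → N (suc i) c * cofactor N (suc i) c ≈ sum (λ d → term (punchIn c d) c)
    expandRow c = begin
      N (suc i) c * cofactor N (suc i) c         ≈⟨ ±-*ʳ e _ _ ⟨
      ±[ e ] (N (suc i) c * Det (minorAt (suc i) c N))
        ≈⟨ ±-cong e (*-congˡ (reflexive (det-suc (minorAt (suc i) c N)))) ⟩
      ±[ e ] (N (suc i) c * sum f)               ≈⟨ ±-cong e (*-distribˡ-sum (N (suc i) c) f) ⟩
      ±[ e ] sum (λ d → N (suc i) c * f d)       ≈⟨ ±-sum e (λ d → N (suc i) c * f d) ⟩
      sum (λ d → ±[ e ] (N (suc i) c * f d))     ≈⟨ sum-cong-≋ (λ d → trans (±-pull e (toℕ d) _ _) (termAt d)) ⟩
      sum (λ d → term (punchIn c d) c)           ∎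
      where
      e : ℕ
      e = suc (toℕ i ℕ.+ toℕ c)
      f : Fin (suc m) → Carrier
      f d = ±[ toℕ d ] (N zero (punchIn c d) * Det (minor rawRing (minorAt (suc i) c N) d))
      termAt : ∀ d → ±[ e ℕ.+ toℕ d ] (N (suc i) c * (N zero (punchIn c d) * Det (minor rawRing (minorAt (suc i) c N) d)))
                   ≈ term (punchIn c d) c
      termAt d = begin
        ±[ e ℕ.+ toℕ d ] y                                ≈⟨ ±-reindex (toℕ i) c d y ⟩
        ±[ X ℕ.+ (toℕ i ℕ.+ toℕ (pinch d c)) ] y
          ≈⟨ ±-cong (X ℕ.+ (toℕ i ℕ.+ toℕ (pinch d c))) (trans (x∙yz≈y∙xz (N (suc i) c) (N zero (punchIn c d)) _)
                                                               (*-congˡ (*-congˡ (det-cong sameEntries)))) ⟩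
        term′ (punchIn c d) c (pinch d c)                 ≡⟨ ≡.cong (term′ (punchIn c d) c) (punchOut′-punchIn-pinch c d) ⟨
        term (punchIn c d) c                              ∎
        where
        X = toℕ (punchIn c d)
        y = N (suc i) c * (N zero (punchIn c d) * Det (minor rawRing (minorAt (suc i) c N) d))
        sameEntries : ∀ r k → minor rawRing (minorAt (suc i) c N) d r k ≈ N (suc (punchIn i r)) (punchIn (punchIn c d) (punchIn (pinch d c) k))
        sameEntries r k = reflexive (≡.cong (N (suc (punchIn i r))) (≡.sym (punchIn-pinch-swap c d k)))

  module Alternating (2-torsion-free : ∀ x → x + x ≈ 0# → x ≈ 0#) where

    -- Expanding along rows 0 and 1 gives Det N = − Det N.
    det-equalRows₀₁ : ∀ {m} (N : Mat Carrier (suc (suc m))) → (∀ c → N zero c ≈ N (suc zero) c) → Det N ≈ 0#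
    det-equalRows₀₁ N rows≈ = 2-torsion-free (Det N) (begin
      Det N + Det N
        ≈⟨ +-congˡ (det-expand N (suc zero)) ⟩
      Det N + sum (λ j → N (suc zero) j * - (±[ toℕ j ] Det (minorAt (suc zero) j N)))
        ≈⟨ +-congˡ (sum-cong-≋ (λ j → *-cong (sym (rows≈ j)) (-‿cong (±-cong (toℕ j) (det-cong (sameMinor j)))))) ⟩
      Det N + sum (λ j → N zero j * - (±[ toℕ j ] Det (minor rawRing N j)))
        ≈⟨ +-congˡ (sum-cong-≋ (λ j → sym (trans (-‿cong (±-*ʳ (toℕ j) (N zero j) (Det (minor rawRing N j))))
                                                  (-‿distribʳ-* (N zero j) (±[ toℕ j ] Det (minor rawRing N j)))))) ⟩
      Det N + sum (λ j → - (±[ toℕ j ] (N zero j * Det (minor rawRing N j))))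
        ≈⟨ +-congˡ (sym (-‿sum (λ j → ±[ toℕ j ] (N zero j * Det (minor rawRing N j))))) ⟩
      Det N + - sum (λ j → ±[ toℕ j ] (N zero j * Det (minor rawRing N j)))
        ≡⟨ ≡.cong (λ x → Det N + - x) (det-suc N) ⟨
      Det N - Det N
        ≈⟨ -‿inverseʳ (Det N) ⟩
      0# ∎)
      where
      sameMinor : ∀ j r k → minorAt (suc zero) j N r k ≈ minor rawRing N j r k
      sameMinor j zero    k = rows≈ (punchIn j k)
      sameMinor j (suc r) k = refl

    -- Expanding along row 1 moves the second equal row into every minor.
    det-equalRows₀ : ∀ {n} (N : Mat Carrier (suc n)) (k : Fin n) → (∀ c → N zero c ≈ N (suc k) c) → Det N ≈ 0#
    det-equalRows₀ N zero    rows≈ = det-equalRows₀₁ N rows≈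
    det-equalRows₀ {suc (suc m)} N (suc k) rows≈ = begin
      Det N                                                    ≈⟨ det-expand N (suc zero) ⟩
      sum (λ j → N (suc zero) j * cofactor N (suc zero) j)     ≈⟨ sum-cong-≋ vanish ⟩
      sum {suc (suc (suc m))} (λ _ → 0#)                       ≈⟨ sum-replicate-zero (suc (suc (suc m))) ⟩
      0#                                                       ∎
      where
      vanish : ∀ j → N (suc zero) j * cofactor N (suc zero) j ≈ 0#
      vanish j = begin
        N (suc zero) j * cofactor N (suc zero) j
          ≈⟨ *-congˡ (±-cong (suc (toℕ j)) (det-equalRows₀ (minorAt (suc zero) j N) k (λ c → rows≈ (punchIn j c)))) ⟩
        N (suc zero) j * ±[ suc (toℕ j) ] 0#   ≈⟨ *-congˡ (±-zero (suc (toℕ j))) ⟩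
        N (suc zero) j * 0#                    ≈⟨ zeroʳ (N (suc zero) j) ⟩
        0# ∎

    det-equalRows : ∀ {n} (N : Mat Carrier n) (i k : Fin n) → i ≢ k → (∀ c → N i c ≈ N k c) → Det N ≈ 0#
    det-equalRows N zero    zero    i≢k rows≈ = ⊥-elim (i≢k ≡.refl)
    det-equalRows N zero    (suc k) i≢k rows≈ = det-equalRows₀ N k rows≈
    det-equalRows N (suc i) zero    i≢k rows≈ = det-equalRows₀ N i (λ c → sym (rows≈ c))
    det-equalRows {suc n} N (suc i) (suc k) i≢k rows≈ = begin
      Det N                                                            ≡⟨ det-suc N ⟩
      sum (λ a → ±[ toℕ a ] (N zero a * Det (minor rawRing N a)))     ≈⟨ sum-cong-≋ vanish ⟩
      sum {suc n} (λ _ → 0#)                                           ≈⟨ sum-replicate-zero (suc n) ⟩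
      0#                                                               ∎
      where
      vanish : ∀ a → ±[ toℕ a ] (N zero a * Det (minor rawRing N a)) ≈ 0#
      vanish a = begin
        ±[ toℕ a ] (N zero a * Det (minor rawRing N a))
          ≈⟨ ±-cong (toℕ a) (*-congˡ (det-equalRows (minor rawRing N a) i k (λ i≡k → i≢k (≡.cong suc i≡k))
                                                                            (λ c → rows≈ (punchIn a c)))) ⟩
        ±[ toℕ a ] (N zero a * 0#)   ≈⟨ ±-cong (toℕ a) (zeroʳ (N zero a)) ⟩
        ±[ toℕ a ] 0#                ≈⟨ ±-zero (toℕ a) ⟩
        0#                           ∎

    -- The left-hand side expands the determinant of M with row i replaced by row k.
    cofactorExpansion-otherRow : ∀ {n} (M : Mat Carrier (suc n)) i k → i ≢ k → sum (λ j → M k j * cofactor M i j) ≈ 0#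
    cofactorExpansion-otherRow M i k i≢k = begin
      sum (λ j → M k j * cofactor M i j)   ≈⟨ sum-cong-≋ (λ j → *-cong (reflexive (≡.sym (rowᵢ j))) (cofactor-cong j)) ⟩
      sum (λ j → M′ i j * cofactor M′ i j) ≈⟨ det-expand M′ i ⟨
      Det M′                               ≈⟨ det-equalRows M′ i k i≢k (λ c → reflexive (≡.trans (rowᵢ c) (≡.sym (rowₖ c)))) ⟩
      0#                                   ∎
      where
      M′ = updateAt M i (λ _ → M k)
      rowᵢ : ∀ c → M′ i c ≡ M k c
      rowᵢ = ≡.cong-app (updateAt-updates i M)
      rowₖ : ∀ c → M′ k c ≡ M k c
      rowₖ = ≡.cong-app (updateAt-minimal k i M (λ k≡i → i≢k (≡.sym k≡i)))
      cofactor-cong : ∀ j → cofactor M i j ≈ cofactor M′ i j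
      cofactor-cong j = ±-cong (toℕ i ℕ.+ toℕ j) (det-cong (λ r c →
        reflexive (≡.sym (≡.cong-app (updateAt-minimal (punchIn i r) i M (punchInᵢ≢i i r)) (punchIn j c)))))

  module Homomorphism (S : RawRing 0ℓ 0ℓ) (φ : RawRing.Carrier S → Carrier)
    (φ-+ : ∀ x y → φ (RawRing._+_ S x y) ≈ φ x + φ y)
    (φ-* : ∀ x y → φ (RawRing._*_ S x y) ≈ φ x * φ y)
    (φ-neg : ∀ x → φ (RawRing.-_ S x) ≈ - φ x)
    (φ-0 : φ (RawRing.0# S) ≈ 0#)
    (φ-1 : φ (RawRing.1# S) ≈ 1#) where

    φ-sum : ∀ {n} (f : Fin n → RawRing.Carrier S) → φ (sumFin S f) ≈ sum (λ i → φ (f i))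
    φ-sum {zero}  f = φ-0
    φ-sum {suc n} f = trans (φ-+ (f zero) (sumFin S (λ i → f (suc i)))) (+-congˡ (φ-sum (λ i → f (suc i))))

    φ-± : ∀ k x → φ (signed S k x) ≈ ±[ k ] φ x
    φ-± zero    x = refl
    φ-± (suc k) x = trans (φ-neg (signed S k x)) (-‿cong (φ-± k x))

    φ-det : ∀ {n} (M : Mat (RawRing.Carrier S) n) → φ (det S M) ≈ Det (λ i j → φ (M i j))
    φ-det {zero}  M = φ-1
    φ-det {suc n} M = begin
      φ (det S M)
        ≈⟨ φ-sum (λ j → signed S (toℕ j) (RawRing._*_ S (M zero j) (det S (minor S M j)))) ⟩
      sum (λ j → φ (signed S (toℕ j) (RawRing._*_ S (M zero j) (det S (minor S M j)))))
        ≈⟨ sum-cong-≋ (λ j → trans (φ-± (toℕ j) _) (±-cong (toℕ j) (trans (φ-* (M zero j) _) (*-congˡ (φ-det (minor S M j)))))) ⟩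
      sum (λ j → ±[ toℕ j ] (φ (M zero j) * Det (minor rawRing (λ i j → φ (M i j)) j)))
        ≡⟨ det-suc (λ i j → φ (M i j)) ⟨
      Det (λ i j → φ (M i j)) ∎

  det-neg : ∀ {n} (M : Mat Carrier n) → Det (λ i j → - M i j) ≈ ±[ n ] Det M
  det-neg {zero}  M = refl
  det-neg {suc n} M = begin
    Det (λ i j → - M i j)
      ≡⟨ det-suc (λ i j → - M i j) ⟩
    sum (λ j → ±[ toℕ j ] (- M zero j * Det (minor rawRing (λ i j → - M i j) j)))
      ≈⟨ sum-cong-≋ (λ j → ±-cong (toℕ j) (*-congˡ { - M zero j} (det-neg (minor rawRing M j)))) ⟩
    sum (λ j → ±[ toℕ j ] (- M zero j * ±[ n ] Det (minor rawRing M j)))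
      ≈⟨ sum-cong-≋ (λ j → trans (±-cong (toℕ j) (pullSign (M zero j) (Det (minor rawRing M j))))
                               (±-comm (toℕ j) (suc n) (M zero j * Det (minor rawRing M j)))) ⟩
    sum (λ j → ±[ suc n ] ±[ toℕ j ] (M zero j * Det (minor rawRing M j)))
      ≈⟨ ±-sum (suc n) (λ j → ±[ toℕ j ] (M zero j * Det (minor rawRing M j))) ⟨
    ±[ suc n ] sum (λ j → ±[ toℕ j ] (M zero j * Det (minor rawRing M j)))
      ≡⟨ ≡.cong ±[ suc n ]_ (det-suc M) ⟨
    ±[ suc n ] Det M ∎
    where
    pullSign : ∀ a b → - a * ±[ n ] b ≈ ±[ suc n ] (a * b)
    pullSign a b = trans (sym (-‿distribˡ-* a (±[ n ] b))) (-‿cong (sym (±-*ʳ n a b)))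

module MatrixRing (R : CommutativeRing 0ℓ 0ℓ) where

  open import Data.Nat as ℕ using (ℕ; zero; suc)
  open import Data.Fin using (Fin; zero; suc; punchIn)
  open import Data.Fin.Properties using (_≟_; punchInᵢ≢i)
  open import Data.Bool using (if_then_else_)
  open import Data.Product using (_,_)
  open import Data.Empty using (⊥-elim)
  open import Relation.Nullary using (yes; no)
  open import Relation.Nullary.Decidable using (⌊_⌋)
  open import Relation.Binary.Core using (Rel)
  open import Relation.Binary.PropositionalEquality as ≡ using (_≡_; _≢_)
  import Algebra.Construct.Pointwise as Pointwise
  open CommutativeRing R hiding (zero)
  open import Algebra.Properties.CommutativeMonoid.Sum +-commutativeMonoid
    using (sum; sum-cong-≋; sum-replicate-zero; sum-remove; ∑-distrib-+; ∑-comm)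
  open import Algebra.Properties.Semiring.Sum semiring using (*-distribˡ-sum; *-distribʳ-sum)
  open import Algebra.Properties.CommutativeSemigroup *-commutativeSemigroup using (x∙yz≈y∙xz)
  open import Relation.Binary.Reasoning.Setoid setoid
  open Determinant R using (Det; cofactor; det-expand; module Alternating)

  δ : ∀ {n} → Fin n → Fin n → Carrier
  δ i j = if ⌊ i ≟ j ⌋ then 1# else 0#

  δ-diag : ∀ {n} (i : Fin n) → δ i i ≡ 1#
  δ-diag i with i ≟ i
  ... | yes _  = ≡.refl
  ... | no i≢i = ⊥-elim (i≢i ≡.refl)

  δ-offDiag : ∀ {n} (i j : Fin n) → i ≢ j → δ i j ≡ 0#
  δ-offDiag i j i≢j with i ≟ j
  ... | yes i≡j = ⊥-elim (i≢j i≡j)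
  ... | no  _   = ≡.refl

  sum-δˡ : ∀ {n} (i : Fin n) (f : Fin n → Carrier) → sum (λ j → δ i j * f j) ≈ f i
  sum-δˡ {suc n} i f = begin
    sum (λ j → δ i j * f j)                                  ≈⟨ sum-remove {i = i} (λ j → δ i j * f j) ⟩
    δ i i * f i + sum (λ b → δ i (punchIn i b) * f (punchIn i b)) ≈⟨ +-cong (*-congʳ (reflexive (δ-diag i))) (sum-cong-≋ offDiag) ⟩
    1# * f i + sum {n} (λ _ → 0#)                            ≈⟨ +-cong (*-identityˡ (f i)) (sum-replicate-zero n) ⟩
    f i + 0#                                                 ≈⟨ +-identityʳ (f i) ⟩
    f i                                                      ∎
    where
    offDiag : ∀ b → δ i (punchIn i b) * f (punchIn i b) ≈ 0#
    offDiag b = trans (*-congʳ (reflexive (δ-offDiag i (punchIn i b) (λ i≡ → punchInᵢ≢i i b (≡.sym i≡))))) (zeroˡ _)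

  sum-δʳ : ∀ {n} (k : Fin n) (f : Fin n → Carrier) → sum (λ j → f j * δ j k) ≈ f k
  sum-δʳ k f = trans (sum-cong-≋ (λ j → trans (*-comm (f j) (δ j k)) (*-congʳ (reflexive (δ-sym j k))))) (sum-δˡ k f)
    where
    δ-sym : ∀ {n} (j k : Fin n) → δ j k ≡ δ k j
    δ-sym j k with j ≟ k | k ≟ j
    ... | yes _   | yes _   = ≡.refl
    ... | no  _   | no  _   = ≡.refl
    ... | yes j≡k | no  k≢j = ⊥-elim (k≢j (≡.sym j≡k))
    ... | no  j≢k | yes k≡j = ⊥-elim (j≢k (≡.sym k≡j))

  module _ {n : ℕ} where

    private module Fin[n]→ = Pointwise (Fin n)

    +ᴹ-abelianGroup : AbelianGroup 0ℓ 0ℓ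
    +ᴹ-abelianGroup = Fin[n]→.abelianGroup (Fin[n]→.abelianGroup +-abelianGroup)

    infix  4 _≈ᴹ_
    infixl 6 _+ᴹ_
    infixl 7 _*ᴹ_ _·ᴹ_
    infix  8 -ᴹ_

    _≈ᴹ_ : Rel (Mat Carrier n) 0ℓ
    _≈ᴹ_ = AbelianGroup._≈_ +ᴹ-abelianGroup

    _+ᴹ_ : Mat Carrier n → Mat Carrier n → Mat Carrier n
    (M +ᴹ N) i j = M i j + N i j

    _*ᴹ_ : Mat Carrier n → Mat Carrier n → Mat Carrier n
    (M *ᴹ N) i k = sum (λ j → M i j * N j k)

    -ᴹ_ : Mat Carrier n → Mat Carrier n
    (-ᴹ M) i j = - M i j

    0ᴹ : Mat Carrier n
    0ᴹ i j = 0#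

    1ᴹ : Mat Carrier n
    1ᴹ = δ

    _·ᴹ_ : Carrier → Mat Carrier n → Mat Carrier n
    (c ·ᴹ M) i j = c * M i j

    *ᴹ-cong : ∀ {M M′ N N′} → M ≈ᴹ M′ → N ≈ᴹ N′ → M *ᴹ N ≈ᴹ M′ *ᴹ N′
    *ᴹ-cong M≈ N≈ i k = sum-cong-≋ (λ j → *-cong (M≈ i j) (N≈ j k))

    *ᴹ-assoc : ∀ M N P → (M *ᴹ N) *ᴹ P ≈ᴹ M *ᴹ (N *ᴹ P)
    *ᴹ-assoc M N P i l = begin
      sum (λ k → sum (λ j → M i j * N j k) * P k l)    ≈⟨ sum-cong-≋ (λ k → *-distribʳ-sum (P k l) (λ j → M i j * N j k)) ⟩
      sum (λ k → sum (λ j → M i j * N j k * P k l))    ≈⟨ ∑-comm (λ k j → M i j * N j k * P k l) ⟩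
      sum (λ j → sum (λ k → M i j * N j k * P k l))    ≈⟨ sum-cong-≋ (λ j → sum-cong-≋ (λ k → *-assoc (M i j) (N j k) (P k l))) ⟩
      sum (λ j → sum (λ k → M i j * (N j k * P k l)))  ≈⟨ sum-cong-≋ (λ j → *-distribˡ-sum (M i j) (λ k → N j k * P k l)) ⟨
      sum (λ j → M i j * sum (λ k → N j k * P k l))    ∎

    *ᴹ-identityˡ : ∀ M → 1ᴹ *ᴹ M ≈ᴹ M
    *ᴹ-identityˡ M i k = sum-δˡ i (λ j → M j k)

    *ᴹ-identityʳ : ∀ M → M *ᴹ 1ᴹ ≈ᴹ M
    *ᴹ-identityʳ M i k = sum-δʳ k (M i)

    *ᴹ-distribˡ-+ᴹ : ∀ M N P → M *ᴹ (N +ᴹ P) ≈ᴹ M *ᴹ N +ᴹ M *ᴹ P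
    *ᴹ-distribˡ-+ᴹ M N P i k = trans (sum-cong-≋ (λ j → distribˡ (M i j) (N j k) (P j k)))
      (∑-distrib-+ (λ j → M i j * N j k) (λ j → M i j * P j k))

    *ᴹ-distribʳ-+ᴹ : ∀ M N P → (N +ᴹ P) *ᴹ M ≈ᴹ N *ᴹ M +ᴹ P *ᴹ M
    *ᴹ-distribʳ-+ᴹ M N P i k = trans (sum-cong-≋ (λ j → distribʳ (M j k) (N i j) (P i j)))
      (∑-distrib-+ (λ j → N i j * M j k) (λ j → P i j * M j k))

    matrixRing : Ring 0ℓ 0ℓ
    matrixRing = record
      { Carrier = Mat Carrier n
      ; _≈_ = _≈ᴹ_
      ; _+_ = _+ᴹ_
      ; _*_ = _*ᴹ_
      ; -_ = -ᴹ_
      ; 0# = 0ᴹ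
      ; 1# = 1ᴹ
      ; isRing = record
        { +-isAbelianGroup = AbelianGroup.isAbelianGroup +ᴹ-abelianGroup
        ; *-cong = *ᴹ-cong
        ; *-assoc = *ᴹ-assoc
        ; *-identity = *ᴹ-identityˡ , *ᴹ-identityʳ
        ; distrib = *ᴹ-distribˡ-+ᴹ , *ᴹ-distribʳ-+ᴹ
        }
      }

    ·ᴹ-cong : ∀ {c d M N} → c ≈ d → M ≈ᴹ N → c ·ᴹ M ≈ᴹ d ·ᴹ N
    ·ᴹ-cong c≈d M≈N i j = *-cong c≈d (M≈N i j)

    ·ᴹ-distribʳ : ∀ c d M → (c + d) ·ᴹ M ≈ᴹ c ·ᴹ M +ᴹ d ·ᴹ M
    ·ᴹ-distribʳ c d M i j = distribʳ (M i j) c d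

    ·ᴹ-distribˡ : ∀ c M N → c ·ᴹ (M +ᴹ N) ≈ᴹ c ·ᴹ M +ᴹ c ·ᴹ N
    ·ᴹ-distribˡ c M N i j = distribˡ c (M i j) (N i j)

    ·ᴹ-assoc : ∀ c d M → c ·ᴹ (d ·ᴹ M) ≈ᴹ (c * d) ·ᴹ M
    ·ᴹ-assoc c d M i j = sym (*-assoc c d (M i j))

    ·ᴹ-*ᴹ : ∀ c M N → (c ·ᴹ M) *ᴹ N ≈ᴹ c ·ᴹ (M *ᴹ N)
    ·ᴹ-*ᴹ c M N i k = trans (sum-cong-≋ (λ j → *-assoc c (M i j) (N j k))) (sym (*-distribˡ-sum c (λ j → M i j * N j k)))

    *ᴹ-·ᴹ : ∀ c M N → M *ᴹ (c ·ᴹ N) ≈ᴹ c ·ᴹ (M *ᴹ N)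
    *ᴹ-·ᴹ c M N i k = trans (sum-cong-≋ (λ j → x∙yz≈y∙xz (M i j) c (N j k))) (sym (*-distribˡ-sum c (λ j → M i j * N j k)))

    0·ᴹ : ∀ M → 0# ·ᴹ M ≈ᴹ 0ᴹ
    0·ᴹ M i j = zeroˡ (M i j)

    1·ᴹ : ∀ M → 1# ·ᴹ M ≈ᴹ M
    1·ᴹ M i j = *-identityˡ (M i j)

  adjugate : ∀ {n} → Mat Carrier n → Mat Carrier n
  adjugate {suc n} M j i = cofactor M i j

  module _ (2-torsion-free : ∀ x → x + x ≈ 0# → x ≈ 0#) where
    open Alternating 2-torsion-free using (cofactorExpansion-otherRow)

    *ᴹ-adjugate : ∀ {n} (M : Mat Carrier n) → M *ᴹ adjugate M ≈ᴹ Det M ·ᴹ 1ᴹ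
    *ᴹ-adjugate {suc n} M k i with k ≟ i
    ... | yes ≡.refl = trans (sym (det-expand M k)) (sym (*-identityʳ (Det M)))
    ... | no  k≢i    = trans (cofactorExpansion-otherRow M i k (λ i≡k → k≢i (≡.sym i≡k))) (sym (zeroʳ (Det M)))

module Telescope (G : AbelianGroup 0ℓ 0ℓ) where

  open import Data.Nat using (ℕ; zero; suc)
  open import Data.Fin using (toℕ)
  open AbelianGroup G
  open import Algebra.Properties.AbelianGroup G using (xyx⁻¹≈y)
  open import Algebra.Properties.CommutativeMonoid.Sum commutativeMonoid using (sum)
  open import Relation.Binary.Reasoning.Setoid setoid

  sum-telescope : ∀ L (F : ℕ → Carrier) → sum {L} (λ t → F (toℕ t) - F (suc (toℕ t))) ≈ F 0 - F L
  sum-telescope zero    F = sym (inverseʳ (F 0))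
  sum-telescope (suc L) F = begin
    (F 0 - F 1) ∙ sum {L} (λ t → F (suc (toℕ t)) - F (suc (suc (toℕ t)))) ≈⟨ ∙-congˡ (sum-telescope L (λ t → F (suc t))) ⟩
    (F 0 - F 1) ∙ (F 1 - F (suc L))       ≈⟨ assoc (F 0) (F 1 ⁻¹) (F 1 - F (suc L)) ⟩
    F 0 ∙ (F 1 ⁻¹ ∙ (F 1 - F (suc L)))    ≈⟨ ∙-congˡ (comm (F 1 ⁻¹) (F 1 - F (suc L))) ⟩
    F 0 ∙ ((F 1 - F (suc L)) - F 1)       ≈⟨ ∙-congˡ (xyx⁻¹≈y (F 1) (F (suc L) ⁻¹)) ⟩
    F 0 - F (suc L)                                                          ∎

module MatrixEvaluation (R : CommutativeRing 0ℓ 0ℓ) {n : ℕ} where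

  open import Data.Nat as ℕ using (zero; suc; _<_)
  open import Data.Fin using (Fin; zero; suc; toℕ; fromℕ<; punchIn)
  open import Data.Fin.Properties using (toℕ-fromℕ<; toℕ-injective; punchInᵢ≢i)
  open import Relation.Binary.PropositionalEquality as ≡ using (_≡_; _≢_)
  open CommutativeRing R using (Carrier) renaming (_≈_ to _≈ᴿ_; _+_ to _+ᴿ_; _*_ to _*ᴿ_; 0# to 0ᴿ)
  open MatrixRing R
  open Ring (matrixRing {n}) hiding (Carrier; zero)
  import Data.Nat.Properties as ℕP
  module ℛ = CommutativeRing R
  open import Algebra.Properties.Semiring.Exp semiring using (_^_; ^-homo-*)
  open import Algebra.Properties.CommutativeMonoid.Sum +-commutativeMonoid
    using (sum; sum-cong-≋; sum-remove; ∑-distrib-+; sum-replicate-zero)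
  open import Algebra.Properties.Semiring.Sum semiring using (*-distribʳ-sum)
  open import Relation.Binary.Reasoning.Setoid setoid

  evalᴹ : ℕ → (ℕ → Carrier) → Mat Carrier n → Mat Carrier n
  evalᴹ L c A = sum {L} (λ t → c (toℕ t) ·ᴹ A ^ toℕ t)

  evalᴹ-cong : ∀ L {c d : ℕ → Carrier} A → (∀ t → c t ≈ᴿ d t) → evalᴹ L c A ≈ evalᴹ L d A
  evalᴹ-cong L A c≈d = sum-cong-≋ {L} (λ t → ·ᴹ-cong (c≈d (toℕ t)) refl)

  evalᴹ-+ : ∀ L (c d : ℕ → Carrier) A → evalᴹ L (λ t → c t +ᴿ d t) A ≈ evalᴹ L c A + evalᴹ L d A
  evalᴹ-+ L c d A = trans (sum-cong-≋ {L} (λ t → ·ᴹ-distribʳ (c (toℕ t)) (d (toℕ t)) (A ^ toℕ t)))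
    (∑-distrib-+ {L} (λ t → c (toℕ t) ·ᴹ A ^ toℕ t) (λ t → d (toℕ t) ·ᴹ A ^ toℕ t))

  ·ᴹ-sum : ∀ {L} a (F : Fin L → Mat Carrier n) → a ·ᴹ sum F ≈ sum (λ t → a ·ᴹ F t)
  ·ᴹ-sum {zero}  a F i j = ℛ.zeroʳ a
  ·ᴹ-sum {suc L} a F = trans (·ᴹ-distribˡ a (F zero) (sum (λ t → F (suc t)))) (+-congˡ (·ᴹ-sum a (λ t → F (suc t))))

  evalᴹ-· : ∀ L a (c : ℕ → Carrier) A → evalᴹ L (λ t → a *ᴿ c t) A ≈ a ·ᴹ evalᴹ L c A
  evalᴹ-· L a c A = trans (sum-cong-≋ {L} (λ t → sym (·ᴹ-assoc a (c (toℕ t)) (A ^ toℕ t))))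
    (sym (·ᴹ-sum {L} a (λ t → c (toℕ t) ·ᴹ A ^ toℕ t)))

  ^-comm : ∀ A t → A ^ t * A ≈ A ^ suc t
  ^-comm A t = begin
    A ^ t * A        ≈⟨ *-congˡ (*-identityʳ A) ⟨
    A ^ t * A ^ 1    ≈⟨ ^-homo-* A t 1 ⟨
    A ^ (t ℕ.+ 1)    ≡⟨ ≡.cong (A ^_) (ℕP.+-comm t 1) ⟩
    A ^ suc t        ∎

  evalᴹ-suc : ∀ L (c : ℕ → Carrier) A → evalᴹ (suc L) c A ≈ c 0 ·ᴹ 1ᴹ + evalᴹ L (λ t → c (suc t)) A * A
  evalᴹ-suc L c A = +-congˡ (begin
    sum {L} (λ t → c (suc (toℕ t)) ·ᴹ A ^ suc (toℕ t)) ≈⟨ sum-cong-≋ {L} (λ t → ·ᴹ-cong {c = c (suc (toℕ t))} ℛ.refl (^-comm A (toℕ t))) ⟨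
    sum {L} (λ t → c (suc (toℕ t)) ·ᴹ (A ^ toℕ t * A)) ≈⟨ sum-cong-≋ {L} (λ t → ·ᴹ-*ᴹ (c (suc (toℕ t))) (A ^ toℕ t) A) ⟨
    sum {L} (λ t → c (suc (toℕ t)) ·ᴹ A ^ toℕ t * A)   ≈⟨ *-distribʳ-sum {L} A (λ t → c (suc (toℕ t)) ·ᴹ A ^ toℕ t) ⟨
    evalᴹ L (λ t → c (suc t)) A * A                    ∎)

  evalᴹ-single : ∀ L m (c : ℕ → Carrier) A → m < L → (∀ t → t ≢ m → c t ≈ᴿ 0ᴿ) → evalᴹ L c A ≈ c m ·ᴹ A ^ m
  evalᴹ-single (suc L) m c A m<L c≈0 = begin
    evalᴹ (suc L) c A
      ≈⟨ sum-remove {i = i} (λ t → c (toℕ t) ·ᴹ A ^ toℕ t) ⟩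
    c (toℕ i) ·ᴹ A ^ toℕ i + sum (λ b → c (toℕ (punchIn i b)) ·ᴹ A ^ toℕ (punchIn i b))
      ≈⟨ +-congˡ (sum-cong-≋ {L} vanish) ⟩
    c (toℕ i) ·ᴹ A ^ toℕ i + sum {L} (λ _ → 0ᴹ)
      ≈⟨ +-congˡ (sum-replicate-zero L) ⟩
    c (toℕ i) ·ᴹ A ^ toℕ i + 0ᴹ
      ≈⟨ +-identityʳ _ ⟩
    c (toℕ i) ·ᴹ A ^ toℕ i
      ≡⟨ ≡.cong (λ s → c s ·ᴹ A ^ s) (toℕ-fromℕ< m<L) ⟩
    c m ·ᴹ A ^ m ∎
    where
    i = fromℕ< m<L
    vanish : ∀ b → c (toℕ (punchIn i b)) ·ᴹ A ^ toℕ (punchIn i b) ≈ 0ᴹ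
    vanish b = trans (·ᴹ-cong (c≈0 _ (λ e → punchInᵢ≢i i b (toℕ-injective (≡.trans e (≡.sym (toℕ-fromℕ< m<L)))))) refl)
                     (0·ᴹ (A ^ toℕ (punchIn i b)))

module Polynomial where

  open import Data.Nat using (zero; suc)
  open import Data.Integer as ℤ using (ℤ; +_)
  import Data.Integer.Properties as ℤP
  open import Data.List using ([]; _∷_; map)
  open import Data.Product using (_,_)
  open import Relation.Binary.PropositionalEquality as ≡ using (_≡_; refl; cong; cong₂; sym; trans)
  open import Data.Integer.Tactic.RingSolver using (solve-∀)

  infix 4 _≈ₚ_
  record _≈ₚ_ (p q : Poly) : Set where
    constructor mk≈ₚ
    field coeff-≡ : ∀ i → coeff p i ≡ coeff q i
  open _≈ₚ_ public

  negP : Poly → Poly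
  negP = map (λ a → ℤ.- a)

  oneP : Poly
  oneP = + 1 ∷ []

  scaleP : ℤ → Poly → Poly
  scaleP a = map (a ℤ.*_)

  shiftP : Poly → Poly
  shiftP p = + 0 ∷ p

  coeff-addP : ∀ p q i → coeff (addP p q) i ≡ coeff p i ℤ.+ coeff q i
  coeff-addP []      q       i       = sym (ℤP.+-identityˡ _)
  coeff-addP (a ∷ p) []      i       = sym (ℤP.+-identityʳ _)
  coeff-addP (a ∷ p) (b ∷ q) zero    = refl
  coeff-addP (a ∷ p) (b ∷ q) (suc i) = coeff-addP p q i

  coeff-scaleP : ∀ a q i → coeff (scaleP a q) i ≡ a ℤ.* coeff q i
  coeff-scaleP a []      i       = sym (ℤP.*-zeroʳ a)
  coeff-scaleP a (b ∷ q) zero    = refl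
  coeff-scaleP a (b ∷ q) (suc i) = coeff-scaleP a q i

  coeff-negP : ∀ q i → coeff (negP q) i ≡ ℤ.- coeff q i
  coeff-negP []      i       = refl
  coeff-negP (b ∷ q) zero    = refl
  coeff-negP (b ∷ q) (suc i) = coeff-negP q i

  coeff-mulP-0 : ∀ p q → coeff (mulP p q) 0 ≡ coeff p 0 ℤ.* coeff q 0
  coeff-mulP-0 []      q = refl
  coeff-mulP-0 (a ∷ p) q = trans (coeff-addP (scaleP a q) (shiftP (mulP p q)) 0)
    (trans (ℤP.+-identityʳ _) (coeff-scaleP a q 0))

  ≈ₚ-refl : ∀ {p} → p ≈ₚ p
  ≈ₚ-refl = mk≈ₚ (λ i → refl)

  ≈ₚ-sym : ∀ {p q} → p ≈ₚ q → q ≈ₚ p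
  ≈ₚ-sym e = mk≈ₚ (λ i → sym (coeff-≡ e i))

  ≈ₚ-trans : ∀ {p q r} → p ≈ₚ q → q ≈ₚ r → p ≈ₚ r
  ≈ₚ-trans e f = mk≈ₚ (λ i → trans (coeff-≡ e i) (coeff-≡ f i))

  addP-cong : ∀ {p p′ q q′} → p ≈ₚ p′ → q ≈ₚ q′ → addP p q ≈ₚ addP p′ q′
  addP-cong {p} {p′} {q} {q′} e f = mk≈ₚ λ i →
    trans (coeff-addP p q i) (trans (cong₂ ℤ._+_ (coeff-≡ e i) (coeff-≡ f i)) (sym (coeff-addP p′ q′ i)))

  negP-cong : ∀ {p q} → p ≈ₚ q → negP p ≈ₚ negP q
  negP-cong {p} {q} e = mk≈ₚ λ i → trans (coeff-negP p i) (trans (cong ℤ.-_ (coeff-≡ e i)) (sym (coeff-negP q i)))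

  scaleP-cong : ∀ a {q q′} → q ≈ₚ q′ → scaleP a q ≈ₚ scaleP a q′
  scaleP-cong a {q} {q′} e = mk≈ₚ λ i →
    trans (coeff-scaleP a q i) (trans (cong (a ℤ.*_) (coeff-≡ e i)) (sym (coeff-scaleP a q′ i)))

  shiftP-cong : ∀ {q q′} → q ≈ₚ q′ → shiftP q ≈ₚ shiftP q′
  coeff-≡ (shiftP-cong e) zero    = refl
  coeff-≡ (shiftP-cong e) (suc i) = coeff-≡ e i

  addP-comm : ∀ p q → addP p q ≈ₚ addP q p
  addP-comm p q = mk≈ₚ λ i → trans (coeff-addP p q i) (trans (ℤP.+-comm (coeff p i) (coeff q i)) (sym (coeff-addP q p i)))

  addP-assoc : ∀ p q r → addP (addP p q) r ≈ₚ addP p (addP q r)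
  addP-assoc p q r = mk≈ₚ λ i → begin
    coeff (addP (addP p q) r) i               ≡⟨ trans (coeff-addP (addP p q) r i) (cong (ℤ._+ coeff r i) (coeff-addP p q i)) ⟩
    coeff p i ℤ.+ coeff q i ℤ.+ coeff r i     ≡⟨ ℤP.+-assoc (coeff p i) (coeff q i) (coeff r i) ⟩
    coeff p i ℤ.+ (coeff q i ℤ.+ coeff r i)   ≡⟨ sym (trans (coeff-addP p (addP q r) i) (cong (λ z → coeff p i ℤ.+ z) (coeff-addP q r i))) ⟩
    coeff (addP p (addP q r)) i               ∎
    where open ≡.≡-Reasoning

  addP-identityʳ : ∀ p → addP p [] ≈ₚ p
  addP-identityʳ p = mk≈ₚ λ i → trans (coeff-addP p [] i) (ℤP.+-identityʳ _)

  negP-inverseˡ : ∀ p → addP (negP p) p ≈ₚ []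
  negP-inverseˡ p = mk≈ₚ λ i → trans (coeff-addP (negP p) p i) (trans (cong (ℤ._+ coeff p i) (coeff-negP p i)) (ℤP.+-inverseˡ (coeff p i)))

  addP-interchange : ∀ p q r s → addP (addP p q) (addP r s) ≈ₚ addP (addP p r) (addP q s)
  addP-interchange p q r s = mk≈ₚ λ i → trans (trans (coeff-addP (addP p q) (addP r s) i) (cong₂ ℤ._+_ (coeff-addP p q i) (coeff-addP r s i)))
    (trans (interchange (coeff p i) (coeff q i) (coeff r i) (coeff s i))
    (sym (trans (coeff-addP (addP p r) (addP q s) i) (cong₂ ℤ._+_ (coeff-addP p r i) (coeff-addP q s i)))))
    where
    interchange : ∀ a b c d → (a ℤ.+ b) ℤ.+ (c ℤ.+ d) ≡ (a ℤ.+ c) ℤ.+ (b ℤ.+ d)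
    interchange = solve-∀

  scaleP-comm : ∀ a b q → scaleP a (scaleP b q) ≈ₚ scaleP b (scaleP a q)
  scaleP-comm a b q = mk≈ₚ λ i → trans (trans (coeff-scaleP a (scaleP b q) i) (cong (a ℤ.*_) (coeff-scaleP b q i)))
    (trans (leftComm a b (coeff q i)) (sym (trans (coeff-scaleP b (scaleP a q) i) (cong (b ℤ.*_) (coeff-scaleP a q i)))))
    where
    leftComm : ∀ a b c → a ℤ.* (b ℤ.* c) ≡ b ℤ.* (a ℤ.* c)
    leftComm = solve-∀

  scaleP-addP : ∀ a p q → scaleP a (addP p q) ≈ₚ addP (scaleP a p) (scaleP a q)
  scaleP-addP a p q = mk≈ₚ λ i → trans (trans (coeff-scaleP a (addP p q) i) (cong (a ℤ.*_) (coeff-addP p q i)))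
    (trans (ℤP.*-distribˡ-+ a (coeff p i) (coeff q i))
    (sym (trans (coeff-addP (scaleP a p) (scaleP a q) i) (cong₂ ℤ._+_ (coeff-scaleP a p i) (coeff-scaleP a q i)))))

  scaleP-shiftP : ∀ a q → scaleP a (shiftP q) ≈ₚ shiftP (scaleP a q)
  coeff-≡ (scaleP-shiftP a q) zero    = ℤP.*-zeroʳ a
  coeff-≡ (scaleP-shiftP a q) (suc i) = refl

  shiftP-addP : ∀ p q → shiftP (addP p q) ≈ₚ addP (shiftP p) (shiftP q)
  coeff-≡ (shiftP-addP p q) zero    = refl
  coeff-≡ (shiftP-addP p q) (suc i) = refl

  mulP-[]ˡ : ∀ {p} q → p ≈ₚ [] → mulP p q ≈ₚ []
  coeff-≡ (mulP-[]ˡ {[]}    q p≈0) i = refl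
  coeff-≡ (mulP-[]ˡ {a ∷ p} q p≈0) i = trans (coeff-addP (scaleP a q) (shiftP (mulP p q)) i)
    (trans (cong₂ ℤ._+_ (trans (coeff-scaleP a q i) (trans (cong (ℤ._* coeff q i) (coeff-≡ p≈0 zero)) (ℤP.*-zeroˡ (coeff q i))))
                        (shifted i))
           (ℤP.+-identityˡ (+ 0)))
    where
    shifted : ∀ i → coeff (shiftP (mulP p q)) i ≡ + 0
    shifted zero    = refl
    shifted (suc i) = coeff-≡ (mulP-[]ˡ {p} q (mk≈ₚ λ j → coeff-≡ p≈0 (suc j))) i

  mulP-[]ʳ : ∀ q → mulP q [] ≈ₚ []
  coeff-≡ (mulP-[]ʳ [])      i = refl
  coeff-≡ (mulP-[]ʳ (a ∷ q)) i = trans (coeff-addP (scaleP a []) (shiftP (mulP q [])) i) (trans (ℤP.+-identityˡ _) (shifted i))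
    where
    shifted : ∀ i → coeff (shiftP (mulP q [])) i ≡ + 0
    shifted zero    = refl
    shifted (suc i) = coeff-≡ (mulP-[]ʳ q) i

  mulP-congˡ : ∀ {p p′} q → p ≈ₚ p′ → mulP p q ≈ₚ mulP p′ q
  mulP-congˡ {[]}    {p′}     q e = ≈ₚ-sym (mulP-[]ˡ q (≈ₚ-sym e))
  mulP-congˡ {a ∷ p} {[]}     q e = mulP-[]ˡ q e
  mulP-congˡ {a ∷ p} {b ∷ p′} q e = addP-cong
    (mk≈ₚ λ i → trans (coeff-scaleP a q i) (trans (cong (ℤ._* coeff q i) (coeff-≡ e zero)) (sym (coeff-scaleP b q i))))
    (shiftP-cong (mulP-congˡ {p} {p′} q (mk≈ₚ λ i → coeff-≡ e (suc i))))

  mulP-congʳ : ∀ p {q q′} → q ≈ₚ q′ → mulP p q ≈ₚ mulP p q′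
  mulP-congʳ []      e = ≈ₚ-refl
  mulP-congʳ (a ∷ p) e = addP-cong (scaleP-cong a e) (shiftP-cong (mulP-congʳ p e))

  mulP-shiftPʳ : ∀ p q → mulP p (shiftP q) ≈ₚ shiftP (mulP p q)
  coeff-≡ (mulP-shiftPʳ [] q) zero    = refl
  coeff-≡ (mulP-shiftPʳ [] q) (suc i) = refl
  mulP-shiftPʳ (a ∷ p) q = ≈ₚ-trans (addP-cong (scaleP-shiftP a q) (shiftP-cong (mulP-shiftPʳ p q)))
    (≈ₚ-sym (shiftP-addP (scaleP a q) (shiftP (mulP p q))))

  mulP-scalePʳ : ∀ p b q → mulP p (scaleP b q) ≈ₚ scaleP b (mulP p q)
  mulP-scalePʳ []      b q = ≈ₚ-refl
  mulP-scalePʳ (a ∷ p) b q = ≈ₚ-trans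
    (addP-cong (scaleP-comm a b q) (≈ₚ-trans (shiftP-cong (mulP-scalePʳ p b q)) (≈ₚ-sym (scaleP-shiftP b (mulP p q)))))
    (≈ₚ-sym (scaleP-addP b (scaleP a q) (shiftP (mulP p q))))

  mulP-distribˡ : ∀ p q r → mulP p (addP q r) ≈ₚ addP (mulP p q) (mulP p r)
  mulP-distribˡ []      q r = ≈ₚ-refl
  mulP-distribˡ (a ∷ p) q r = ≈ₚ-trans
    (addP-cong (scaleP-addP a q r) (≈ₚ-trans (shiftP-cong (mulP-distribˡ p q r)) (shiftP-addP (mulP p q) (mulP p r))))
    (addP-interchange (scaleP a q) (scaleP a r) (shiftP (mulP p q)) (shiftP (mulP p r)))

  mulP-identityʳ : ∀ p → mulP p oneP ≈ₚ p
  coeff-≡ (mulP-identityʳ [])      i       = refl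
  coeff-≡ (mulP-identityʳ (a ∷ p)) zero    = trans (coeff-addP (scaleP a oneP) (shiftP (mulP p oneP)) zero)
    (trans (ℤP.+-identityʳ (a ℤ.* + 1)) (ℤP.*-identityʳ a))
  coeff-≡ (mulP-identityʳ (a ∷ p)) (suc i) = trans (coeff-addP (scaleP a oneP) (shiftP (mulP p oneP)) (suc i))
    (trans (ℤP.+-identityˡ _) (coeff-≡ (mulP-identityʳ p) i))

  mulP-identityˡ : ∀ q → mulP oneP q ≈ₚ q
  mulP-identityˡ q = mk≈ₚ λ i → trans (coeff-addP (scaleP (+ 1) q) (shiftP []) i)
    (trans (cong₂ ℤ._+_ (coeff-scaleP (+ 1) q i) (shifted i)) (trans (ℤP.+-identityʳ _) (ℤP.*-identityˡ (coeff q i))))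
    where
    shifted : ∀ i → coeff (shiftP []) i ≡ + 0
    shifted zero    = refl
    shifted (suc i) = refl

  ∷-split : ∀ a p → (a ∷ p) ≈ₚ addP (scaleP a oneP) (shiftP p)
  coeff-≡ (∷-split a p) zero    = sym (trans (ℤP.+-identityʳ (a ℤ.* + 1)) (ℤP.*-identityʳ a))
  coeff-≡ (∷-split a p) (suc i) = refl

  mulP-comm : ∀ p q → mulP p q ≈ₚ mulP q p
  mulP-comm []      q = ≈ₚ-sym (mulP-[]ʳ q)
  mulP-comm (a ∷ p) q = ≈ₚ-sym (≈ₚ-trans (mulP-congʳ q (∷-split a p)) (≈ₚ-trans (mulP-distribˡ q (scaleP a oneP) (shiftP p))
    (addP-cong (≈ₚ-trans (mulP-scalePʳ q a oneP) (scaleP-cong a (mulP-identityʳ q)))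
               (≈ₚ-trans (mulP-shiftPʳ q p) (shiftP-cong (mulP-comm q p))))))

  mulP-distribʳ : ∀ r p q → mulP (addP p q) r ≈ₚ addP (mulP p r) (mulP q r)
  mulP-distribʳ r p q = ≈ₚ-trans (mulP-comm (addP p q) r)
    (≈ₚ-trans (mulP-distribˡ r p q) (addP-cong (mulP-comm r p) (mulP-comm r q)))

  mulP-assoc : ∀ p q r → mulP (mulP p q) r ≈ₚ mulP p (mulP q r)
  mulP-assoc []      q r = ≈ₚ-refl
  mulP-assoc (a ∷ p) q r = ≈ₚ-trans (mulP-distribʳ r (scaleP a q) (shiftP (mulP p q)))
    (addP-cong scaledFactor (≈ₚ-trans shiftedFactor (shiftP-cong (mulP-assoc p q r))))
    where
    scaledFactor : mulP (scaleP a q) r ≈ₚ scaleP a (mulP q r)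
    scaledFactor = ≈ₚ-trans (mulP-comm (scaleP a q) r) (≈ₚ-trans (mulP-scalePʳ r a q) (scaleP-cong a (mulP-comm r q)))
    shiftedFactor : mulP (shiftP (mulP p q)) r ≈ₚ shiftP (mulP (mulP p q) r)
    shiftedFactor = ≈ₚ-trans (mulP-comm (shiftP (mulP p q)) r)
      (≈ₚ-trans (mulP-shiftPʳ r (mulP p q)) (shiftP-cong (mulP-comm r (mulP p q))))

  ℤ[x] : CommutativeRing 0ℓ 0ℓ
  ℤ[x] = record
    { Carrier = Poly
    ; _≈_ = _≈ₚ_
    ; _+_ = addP
    ; _*_ = mulP
    ; -_ = negP
    ; 0# = []
    ; 1# = oneP
    ; isCommutativeRing = record
      { isRing = record
        { +-isAbelianGroup = record
          { isGroup = record
            { isMonoid = record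
              { isSemigroup = record
                { isMagma = record
                  { isEquivalence = record { refl = ≈ₚ-refl ; sym = ≈ₚ-sym ; trans = ≈ₚ-trans }
                  ; ∙-cong = addP-cong }
                ; assoc = addP-assoc }
              ; identity = (λ p → ≈ₚ-refl) , addP-identityʳ }
            ; inverse = negP-inverseˡ , (λ p → ≈ₚ-trans (addP-comm p (negP p)) (negP-inverseˡ p))
            ; ⁻¹-cong = negP-cong }
          ; comm = addP-comm }
        ; *-cong = λ {p} {p′} {q} {q′} e f → ≈ₚ-trans (mulP-congˡ q e) (mulP-congʳ p′ f)
        ; *-assoc = mulP-assoc
        ; *-identity = mulP-identityˡ , mulP-identityʳ
        ; distrib = mulP-distribˡ , mulP-distribʳ }
      ; *-comm = mulP-comm } }

  ℤ[x]-2-torsion-free : ∀ p → addP p p ≈ₚ [] → p ≈ₚ []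
  ℤ[x]-2-torsion-free p 2p≈0 = mk≈ₚ λ i → ℤP.*-cancelˡ-≡ (+ 2) (coeff p i) (+ 0)
    (trans (double (coeff p i)) (trans (trans (sym (coeff-addP p p i)) (coeff-≡ 2p≈0 i)) (sym (ℤP.*-zeroʳ (+ 2)))))
    where
    double : ∀ a → + 2 ℤ.* a ≡ a ℤ.+ a
    double = solve-∀

module CayleyHamilton {n : ℕ} (A : Mat ℤ n) where

  open import Data.Nat as ℕ using (ℕ; zero; suc; _≤_)
  import Data.Nat.Properties as ℕP
  open import Data.Integer as ℤ using (ℤ; +_)
  import Data.Integer.Properties as ℤP
  import Data.Integer.Divisibility.Signed as ℤ∣
  open import Data.Fin using (Fin; zero; suc; toℕ)
  open import Data.Fin.Properties using (_≟_)
  open import Data.List using ([]; _∷_; length)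
  open import Data.Bool using (true; false; if_then_else_)
  open import Data.Product using (∃-syntax; _,_; proj₁; proj₂)
  open import Data.Sum using (inj₁; inj₂)
  open import Data.Empty using (⊥-elim)
  open import Relation.Nullary using (yes; no)
  open import Relation.Nullary.Decidable using (⌊_⌋)
  open import Relation.Binary.PropositionalEquality as ≡ using (_≡_; _≢_; refl; sym; trans; cong; cong₂)
  open import Algebra.Bundles using (Ring; CommutativeRing)
  open import Data.Integer.Tactic.RingSolver using (solve-∀)
  import Relation.Binary.Reasoning.Setoid
  open Polynomial
  open FinIndex using (upperBound)

  private
    ℤ-ring = ℤP.+-*-commutativeRing
    module ℤ[x]-Det = Determinant ℤ[x]
    module ℤ[x]-Mat = MatrixRing ℤ[x]

  open Determinant ℤ-ring using (Det; ±[_]_; det-cong; det-neg; ±-cases; -‿sum; module Homomorphism)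
  open MatrixRing ℤ-ring using (δ; sum-δˡ; _·ᴹ_; matrixRing; ·ᴹ-cong; *ᴹ-·ᴹ; 1·ᴹ)
  open MatrixEvaluation ℤ-ring {n}
  open Ring (matrixRing {n}) hiding (Carrier; zero)
    renaming (_≈_ to _≈ᴹ_; _+_ to _+ᴹ_; _*_ to _*ᴹ_; -_ to -ᴹ_; 0# to 0ᴹ; 1# to 1ᴹ;
              refl to ≈ᴹ-refl; sym to ≈ᴹ-sym; trans to ≈ᴹ-trans)
  open import Algebra.Properties.Ring (matrixRing {n}) using (x[y-z]≈xy-xz; +-inverseʳ-unique; +-inverseˡ-unique; -‿distribˡ-*; -0#≈0#)
  module ≈ᴹ-Reasoning = Relation.Binary.Reasoning.Setoid setoid
  open Telescope (Ring.+-abelianGroup (matrixRing {n})) using (sum-telescope)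
  open import Algebra.Properties.Semiring.Exp (Ring.semiring (matrixRing {n})) using (_^_)
  open import Algebra.Properties.CommutativeMonoid.Sum (CommutativeRing.+-commutativeMonoid ℤ-ring)
    using (sum; sum-cong-≋; ∑-distrib-+)
  open import Algebra.Properties.CommutativeMonoid.Sum (Ring.+-commutativeMonoid (matrixRing {n}))
    using () renaming (sum to sumᴹ; sum-cong-≋ to sumᴹ-cong-≋)

  xI-A : Mat Poly n
  xI-A i j = if ⌊ i ≟ j ⌋ then (ℤ.- A i j) ∷ + 1 ∷ [] else (ℤ.- A i j) ∷ []

  h : Poly
  h = charPoly A

  -- charPoly is a determinant in the raw ring polyRawRing, which lacks the setoid of ℤ[x].
  h≈det : h ≈ₚ ℤ[x]-Det.Det xI-A
  h≈det = φ-det xI-A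
    where
    open ℤ[x]-Det.Homomorphism polyRawRing (λ p → p)
      (λ _ _ → ≈ₚ-refl) (λ _ _ → ≈ₚ-refl) (λ _ → ≈ₚ-refl) ≈ₚ-refl ≈ₚ-refl

  open import Algebra.Properties.CommutativeMonoid.Sum (CommutativeRing.+-commutativeMonoid ℤ[x])
    using () renaming (sum to sumₚ)

  coeff-sum : ∀ {m} (f : Fin m → Poly) t → coeff (sumₚ f) t ≡ sum (λ j → coeff (f j) t)
  coeff-sum {zero}  f t = refl
  coeff-sum {suc m} f t = trans (coeff-addP (f zero) (sumₚ (λ j → f (suc j))) t)
    (cong (λ z → coeff (f zero) t ℤ.+ z) (coeff-sum (λ j → f (suc j)) t))

  coeff-length : ∀ p t → length p ≤ t → coeff p t ≡ + 0
  coeff-length []      t       _            = refl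
  coeff-length (a ∷ p) (suc t) (ℕ.s≤s len≤t) = coeff-length p t len≤t

  coeff-xI-A-mul : ∀ k j q t → coeff (mulP (xI-A k j) q) t ≡ ℤ.- A k j ℤ.* coeff q t ℤ.+ δ k j ℤ.* coeff (shiftP q) t
  coeff-xI-A-mul k j q t with ⌊ k ≟ j ⌋
  ... | true  = trans (coeff-addP (scaleP (ℤ.- A k j) q) (shiftP (mulP oneP q)) t)
                      (cong₂ ℤ._+_ (coeff-scaleP (ℤ.- A k j) q t) (trans (coeff-≡ (shiftP-cong (mulP-identityˡ q)) t) (sym (ℤP.*-identityˡ _))))
  ... | false = trans (coeff-addP (scaleP (ℤ.- A k j) q) (shiftP []) t)
                      (cong₂ ℤ._+_ (coeff-scaleP (ℤ.- A k j) q t) (trans (coeff-shiftP-[] t) (sym (ℤP.*-zeroˡ (coeff (shiftP q) t)))))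
    where
    coeff-shiftP-[] : ∀ t → coeff (shiftP []) t ≡ + 0
    coeff-shiftP-[] zero    = refl
    coeff-shiftP-[] (suc t) = refl

  adj : Mat Poly n
  adj = ℤ[x]-Mat.adjugate xI-A

  -- adj (x·1 − A) = ∑ₜ xᵗ·B t
  B : ℕ → Mat ℤ n
  B t j i = coeff (adj j i) t

  -- B₋ t = B (t − 1), and B₋ 0 = 0
  B₋ : ℕ → Mat ℤ n
  B₋ t j i = coeff (shiftP (adj j i)) t

  coeff-det·δ : ∀ (k i : Fin n) t → coeff (mulP (ℤ[x]-Det.Det xI-A) (ℤ[x]-Mat.δ k i)) t ≡ coeff h t ℤ.* δ k i
  coeff-det·δ k i t with ⌊ k ≟ i ⌋
  ... | true  = trans (coeff-≡ (mulP-identityʳ (ℤ[x]-Det.Det xI-A)) t) (trans (sym (coeff-≡ h≈det t)) (sym (ℤP.*-identityʳ _)))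
  ... | false = trans (coeff-≡ (mulP-[]ʳ (ℤ[x]-Det.Det xI-A)) t) (sym (ℤP.*-zeroʳ (coeff h t)))

  -- Comparing coefficients of xᵗ in (x·1 − A)·adj (x·1 − A) = h·1.
  adjugateCoefficients : ∀ t → B₋ t - A *ᴹ B t ≈ᴹ coeff h t ·ᴹ 1ᴹ
  adjugateCoefficients t k i = begin
    B₋ t k i ℤ.+ ℤ.- sum (λ j → A k j ℤ.* B t j i)
      ≡⟨ ℤP.+-comm (B₋ t k i) _ ⟩
    ℤ.- sum (λ j → A k j ℤ.* B t j i) ℤ.+ B₋ t k i
      ≡⟨ cong₂ ℤ._+_ (trans (-‿sum (λ j → A k j ℤ.* B t j i)) (sum-cong-≋ (λ j → ℤP.neg-distribˡ-* (A k j) (B t j i))))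
                     (sym (sum-δˡ k (λ j → B₋ t j i))) ⟩
    sum (λ j → ℤ.- A k j ℤ.* B t j i) ℤ.+ sum (λ j → δ k j ℤ.* B₋ t j i)
      ≡⟨ sym (∑-distrib-+ (λ j → ℤ.- A k j ℤ.* B t j i) (λ j → δ k j ℤ.* B₋ t j i)) ⟩
    sum (λ j → ℤ.- A k j ℤ.* B t j i ℤ.+ δ k j ℤ.* B₋ t j i)
      ≡⟨ sum-cong-≋ (λ j → sym (coeff-xI-A-mul k j (adj j i) t)) ⟩
    sum (λ j → coeff (mulP (xI-A k j) (adj j i)) t)
      ≡⟨ sym (coeff-sum (λ j → mulP (xI-A k j) (adj j i)) t) ⟩
    coeff ((xI-A ℤ[x]-Mat.*ᴹ adj) k i) t
      ≡⟨ coeff-≡ (ℤ[x]-Mat.*ᴹ-adjugate ℤ[x]-2-torsion-free xI-A k i) t ⟩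
    coeff (mulP (ℤ[x]-Det.Det xI-A) (ℤ[x]-Mat.δ k i)) t
      ≡⟨ coeff-det·δ k i t ⟩
    coeff h t ℤ.* δ k i ∎
    where open ≡.≡-Reasoning

  -- The terms hₜ Aᵗ of h(A) telescope along F.
  F : ℕ → Mat ℤ n
  F t = A ^ t *ᴹ B₋ t

  term-telescopes : ∀ t → coeff h t ·ᴹ A ^ t ≈ᴹ F t - F (suc t)
  term-telescopes t = begin
    coeff h t ·ᴹ A ^ t              ≈⟨ ·ᴹ-cong {c = coeff h t} refl (*-identityʳ (A ^ t)) ⟨
    coeff h t ·ᴹ (A ^ t *ᴹ 1ᴹ)      ≈⟨ *ᴹ-·ᴹ (coeff h t) (A ^ t) 1ᴹ ⟨
    A ^ t *ᴹ (coeff h t ·ᴹ 1ᴹ)      ≈⟨ *-congˡ {x = A ^ t} (adjugateCoefficients t) ⟨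
    A ^ t *ᴹ (B₋ t - A *ᴹ B t)      ≈⟨ x[y-z]≈xy-xz (A ^ t) (B₋ t) (A *ᴹ B t) ⟩
    F t - A ^ t *ᴹ (A *ᴹ B t)       ≈⟨ +-congˡ {x = F t} (-‿cong (≈ᴹ-trans (≈ᴹ-sym (*-assoc (A ^ t) A (B t))) (*-congʳ (^-comm A t)))) ⟩
    F t - F (suc t)                 ∎
    where open ≈ᴹ-Reasoning

  evalᴹ-charPoly : ∀ L → evalᴹ L (coeff h) A ≈ᴹ -ᴹ F L
  evalᴹ-charPoly L = begin
    evalᴹ L (coeff h) A                           ≈⟨ sumᴹ-cong-≋ {L} (λ t → term-telescopes (toℕ t)) ⟩
    sumᴹ {L} (λ t → F (toℕ t) - F (suc (toℕ t)))  ≈⟨ sum-telescope L F ⟩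
    F 0 - F L                                     ≈⟨ +-congʳ (≈ᴹ-trans (*-identityˡ (B₋ 0)) (λ j i → refl)) ⟩
    0ᴹ - F L                                      ≈⟨ +-identityˡ (-ᴹ F L) ⟩
    -ᴹ F L                                        ∎
    where open ≈ᴹ-Reasoning

  B-vanishes : ∃[ D ] ∀ t → D ≤ t → B t ≈ᴹ 0ᴹ
  B-vanishes with upperBound (λ j → proj₁ (upperBound (λ i → length (adj j i))))
  ... | D , bound = D , λ t D≤t j i →
    coeff-length (adj j i) t (ℕP.≤-trans (proj₂ (upperBound (λ i → length (adj j i))) i) (ℕP.≤-trans (bound j) D≤t))

  cayley-hamilton : ∃[ D ] ∀ L → D ≤ L → evalᴹ L (coeff h) A ≈ᴹ 0ᴹ
  cayley-hamilton with B-vanishes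
  ... | D , vanish = suc D , λ { (suc L) (ℕ.s≤s D≤L) → begin
    evalᴹ (suc L) (coeff h) A       ≈⟨ evalᴹ-charPoly (suc L) ⟩
    -ᴹ (A ^ suc L *ᴹ B L)           ≈⟨ -‿cong (*-congˡ {x = A ^ suc L} (vanish L D≤L)) ⟩
    -ᴹ (A ^ suc L *ᴹ 0ᴹ)            ≈⟨ -‿cong (zeroʳ (A ^ suc L)) ⟩
    -ᴹ 0ᴹ                           ≈⟨ -0#≈0# ⟩
    0ᴹ                              ∎ }
    where
    open ≈ᴹ-Reasoning

  constantTerm : coeff h 0 ≡ ±[ n ] detℤ A
  constantTerm = begin
    coeff h 0                           ≡⟨ φ-det xI-A ⟩
    Det (λ i j → coeff (xI-A i j) 0)    ≡⟨ det-cong xI-A₀ ⟩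
    Det (λ i j → ℤ.- A i j)             ≡⟨ det-neg A ⟩
    ±[ n ] detℤ A                       ∎
    where
    open ≡.≡-Reasoning
    open Homomorphism polyRawRing (λ p → coeff p 0) (λ p q → coeff-addP p q 0) coeff-mulP-0 (λ p → coeff-negP p 0) refl refl
    xI-A₀ : ∀ i j → coeff (xI-A i j) 0 ≡ ℤ.- A i j
    xI-A₀ i j with ⌊ i ≟ j ⌋
    ... | true  = refl
    ... | false = refl

  quasiInverse₀ : ∃[ Q ] Q *ᴹ A ≈ᴹ ℤ.- coeff h 0 ·ᴹ 1ᴹ
  quasiInverse₀ with cayley-hamilton
  ... | D , h[A]≈0 = Q₀ , ≈ᴹ-trans Q₀A (λ k i → ℤP.neg-distribˡ-* (coeff h 0) (δ k i))
    where
    -- h(A) = h₀ + (∑ₜ hₜ₊₁ Aᵗ) A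
    Q₀ : Mat ℤ n
    Q₀ = evalᴹ D (λ t → coeff h (suc t)) A
    Q₀A : Q₀ *ᴹ A ≈ᴹ -ᴹ (coeff h 0 ·ᴹ 1ᴹ)
    Q₀A = +-inverseʳ-unique (coeff h 0 ·ᴹ 1ᴹ) (Q₀ *ᴹ A)
      (≈ᴹ-trans (≈ᴹ-sym (evalᴹ-suc D (coeff h) A)) (h[A]≈0 (suc D) (ℕP.n≤1+n D)))

  leftQuasiInverse : ∃[ Q ] Q *ᴹ A ≈ᴹ detℤ A ·ᴹ 1ᴹ
  leftQuasiInverse with quasiInverse₀ | ±-cases n (detℤ A)
  ... | Q , QA | inj₁ h₀≡d  = -ᴹ Q , ≈ᴹ-trans (≈ᴹ-sym (-‿distribˡ-* Q A)) (λ k i →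
    trans (cong ℤ.-_ (QA k i)) (trans (ℤP.neg-distribˡ-* (ℤ.- coeff h 0) (δ k i))
      (cong (ℤ._* δ k i) (trans (ℤP.neg-involutive (coeff h 0)) (trans constantTerm h₀≡d)))))
  ... | Q , QA | inj₂ h₀≡-d = Q , λ k i →
    trans (QA k i) (cong (ℤ._* δ k i) (trans (cong ℤ.-_ (trans constantTerm h₀≡-d)) (ℤP.neg-involutive (detℤ A))))

  xPow-diag : xPow n n ≡ + 1
  xPow-diag with n ℕ.≟ n
  ... | yes _   = refl
  ... | no  n≢n = ⊥-elim (n≢n refl)

  xPow-offDiag : ∀ t → t ≢ n → xPow n t ≡ + 0
  xPow-offDiag t t≢n with t ℕ.≟ n
  ... | yes t≡n = ⊥-elim (t≢n t≡n)
  ... | no  _   = refl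

  nilpotentModulo : ∀ p → CongXPowMod h n p → ∃[ N ] A ^ n ≈ᴹ + p ·ᴹ N
  nilpotentModulo p h≡xⁿ with cayley-hamilton
  ... | D , h[A]≈0 = -ᴹ E , ≈ᴹ-trans (+-inverseˡ-unique (A ^ n) (+ p ·ᴹ E) (begin
      A ^ n +ᴹ + p ·ᴹ E                                        ≈⟨ +-congʳ (1·ᴹ (A ^ n)) ⟨
      + 1 ·ᴹ A ^ n +ᴹ + p ·ᴹ E                                 ≈⟨ +-cong xⁿ[A] (evalᴹ-· L (+ p) q A) ⟨
      evalᴹ L (xPow n) A +ᴹ evalᴹ L (λ t → + p ℤ.* q t) A      ≈⟨ evalᴹ-+ L (xPow n) (λ t → + p ℤ.* q t) A ⟨
      evalᴹ L (λ t → xPow n t ℤ.+ + p ℤ.* q t) A               ≈⟨ evalᴹ-cong L A h-split ⟨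
      evalᴹ L (coeff h) A                                      ≈⟨ h[A]≈0 L (ℕP.m≤m+n D (suc n)) ⟩
      0ᴹ                                                       ∎))
      (λ i j → ℤP.neg-distribʳ-* (+ p) (E i j))
    where
    open ≈ᴹ-Reasoning
    L = D ℕ.+ suc n
    p∣h-xⁿ : ∀ t → + p ℤ∣.∣ (coeff h t ℤ.- xPow n t)
    p∣h-xⁿ t = ℤ∣.∣ᵤ⇒∣ {+ p} {coeff h t ℤ.- xPow n t} (h≡xⁿ t)
    q : ℕ → ℤ
    q t = ℤ∣.quotient (p∣h-xⁿ t)
    E : Mat ℤ n
    E = evalᴹ L q A
    h-split : ∀ t → coeff h t ≡ xPow n t ℤ.+ + p ℤ.* q t
    h-split t = trans (split (coeff h t) (xPow n t))
      (cong (λ z → xPow n t ℤ.+ z) (trans (ℤ∣._∣_.equality (p∣h-xⁿ t)) (ℤP.*-comm (q t) (+ p))))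
      where
      split : ∀ a b → a ≡ b ℤ.+ (a ℤ.- b)
      split = solve-∀
    xⁿ[A] : evalᴹ L (xPow n) A ≈ᴹ + 1 ·ᴹ A ^ n
    xⁿ[A] = ≈ᴹ-trans (evalᴹ-single L n (xPow n) A (ℕP.m≤n+m (suc n) D) (λ t t≢n → xPow-offDiag t t≢n))
                     (λ i j → cong (ℤ._* (A ^ n) i j) xPow-diag)

module Integrality where

  open import Data.Nat as ℕ using (ℕ; zero; suc)
  import Data.Nat.Properties as ℕP
  open import Function using (_∘_)
  open import Data.Integer as ℤ using (ℤ; +_; -[1+_])
  import Data.Integer.Properties as ℤP
  open import Data.Rational as ℚ using (ℚ; mkℚ)
  import Data.Rational.Properties as ℚP
  open import Data.Rational.Solver using (module +-*-Solver)
  import Data.Nat.Coprimality as Coprime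
  open import Data.Fin using (Fin; zero; suc)
  open import Data.Product using (∃-syntax; _,_)
  open import Relation.Binary.PropositionalEquality as ≡ using (_≡_; refl; cong; cong₂; sym; trans; subst)
  open import Algebra.Bundles using (CommutativeRing)
  open import Algebra.Properties.CommutativeMonoid.Sum (CommutativeRing.+-commutativeMonoid ℚP.+-*-commutativeRing)
    using (sum)
  open +-*-Solver

  toℚ-mkℚ : ∀ a → toℚ a ≡ mkℚ a 0 (Coprime.sym (Coprime.1-coprimeTo ℤ.∣ a ∣))
  toℚ-mkℚ (+ n)    = ℚP.normalize-coprime (Coprime.sym (Coprime.1-coprimeTo n))
  toℚ-mkℚ -[1+ n ] = cong ℚ.-_ (ℚP.normalize-coprime (Coprime.sym (Coprime.1-coprimeTo (suc n))))

  toℚ-+ : ∀ a b → toℚ (a ℤ.+ b) ≡ toℚ a ℚ.+ toℚ b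
  toℚ-+ a b rewrite toℚ-mkℚ a | toℚ-mkℚ b = cong (ℚ._/ 1) (sym (cong₂ ℤ._+_ (ℤP.*-identityʳ a) (ℤP.*-identityʳ b)))

  toℚ-* : ∀ a b → toℚ (a ℤ.* b) ≡ toℚ a ℚ.* toℚ b
  toℚ-* a b rewrite toℚ-mkℚ a | toℚ-mkℚ b = refl

  toℚ-neg : ∀ a → toℚ (ℤ.- a) ≡ ℚ.- toℚ a
  toℚ-neg a = trans (toℚ-mkℚ (ℤ.- a)) (trans (mkℚ-neg a) (cong ℚ.-_ (sym (toℚ-mkℚ a))))
    where
    mkℚ-neg : ∀ a → mkℚ (ℤ.- a) 0 (Coprime.sym (Coprime.1-coprimeTo ℤ.∣ ℤ.- a ∣))
                  ≡ ℚ.- mkℚ a 0 (Coprime.sym (Coprime.1-coprimeTo ℤ.∣ a ∣))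
    mkℚ-neg (+ zero)  = refl
    mkℚ-neg (+ suc n) = refl
    mkℚ-neg -[1+ n ]  = refl

  toℚ-pow : ∀ a m → toℚ (a ℤ.^ m) ≡ powℚ (toℚ a) m
  toℚ-pow a zero    = refl
  toℚ-pow a (suc m) = trans (toℚ-* a (a ℤ.^ m)) (cong (toℚ a ℚ.*_) (toℚ-pow a m))

  IsInt-toℚ : ∀ a → IsInt (toℚ a)
  IsInt-toℚ a = a , refl

  IsInt-+ : ∀ {p q} → IsInt p → IsInt q → IsInt (p ℚ.+ q)
  IsInt-+ (a , refl) (b , refl) = a ℤ.+ b , sym (toℚ-+ a b)

  IsInt-* : ∀ {p q} → IsInt p → IsInt q → IsInt (p ℚ.* q)
  IsInt-* (a , refl) (b , refl) = a ℤ.* b , sym (toℚ-* a b)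

  IsInt-neg : ∀ {p} → IsInt p → IsInt (ℚ.- p)
  IsInt-neg (a , refl) = ℤ.- a , sym (toℚ-neg a)

  IsInt-sum : ∀ {n} (f : Fin n → ℚ) → (∀ i → IsInt (f i)) → IsInt (sum f)
  IsInt-sum {zero}  f f-int = + 0 , refl
  IsInt-sum {suc n} f f-int = IsInt-+ (f-int zero) (IsInt-sum (λ i → f (suc i)) (λ i → f-int (suc i)))

  IntV : ∀ {n} → Vecℚ n → Set
  IntV x = ∀ i → IsInt (x i)

  powℚ-+ : ∀ q a b → powℚ q (a ℕ.+ b) ≡ powℚ q a ℚ.* powℚ q b
  powℚ-+ q zero    b = sym (ℚP.*-identityˡ (powℚ q b))
  powℚ-+ q (suc a) b = trans (cong (q ℚ.*_) (powℚ-+ q a b)) (sym (ℚP.*-assoc q (powℚ q a) (powℚ q b)))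

  module _ (d : ℤ) where

    private
      D = toℚ d

    raiseExponent : ∀ q a b → IsInt (q ℚ.* powℚ D a) → IsInt (q ℚ.* powℚ D (a ℕ.+ b))
    raiseExponent q a b q·Dᵃ = subst IsInt
      (trans (ℚP.*-assoc q (powℚ D a) (powℚ D b)) (cong (q ℚ.*_) (sym (powℚ-+ D a b))))
      (IsInt-* q·Dᵃ (subst IsInt (toℚ-pow d b) (IsInt-toℚ (d ℤ.^ b))))

    IsInt⇒InZinv : ∀ {q} → IsInt q → InZinv d q
    IsInt⇒InZinv {q} (z , q≡z) = 0 , z , trans (ℚP.*-identityʳ q) q≡z

    raiseExponent′ : ∀ q a b → IsInt (q ℚ.* powℚ D a) → IsInt (q ℚ.* powℚ D (b ℕ.+ a))
    raiseExponent′ q a b = subst (λ e → IsInt (q ℚ.* powℚ D e)) (ℕP.+-comm a b) ∘ raiseExponent q a b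

    InZinv-+ : ∀ p q → InZinv d p → InZinv d q → InZinv d (p ℚ.+ q)
    InZinv-+ p q (a , p·Dᵃ) (b , q·Dᵇ) = a ℕ.+ b ,
      subst IsInt (sym (ℚP.*-distribʳ-+ (powℚ D (a ℕ.+ b)) p q)) (IsInt-+ (raiseExponent p a b p·Dᵃ) (raiseExponent′ q b a q·Dᵇ))

    InZinv-* : ∀ p q → InZinv d p → InZinv d q → InZinv d (p ℚ.* q)
    InZinv-* p q (a , p·Dᵃ) (b , q·Dᵇ) = a ℕ.+ b , subst IsInt (sym (trans (cong ((p ℚ.* q) ℚ.*_) (powℚ-+ D a b))
      (solve 4 (λ p q x y → (p :* q) :* (x :* y) := (p :* x) :* (q :* y)) refl p q (powℚ D a) (powℚ D b))))
      (IsInt-* p·Dᵃ q·Dᵇ)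

    InZinv-sum : ∀ {n} (f : Fin n → ℚ) → (∀ i → InZinv d (f i)) → InZinv d (sum f)
    InZinv-sum {zero}  f f∈ℛ = IsInt⇒InZinv (+ 0 , refl)
    InZinv-sum {suc n} f f∈ℛ = InZinv-+ (f zero) (sum (λ i → f (suc i))) (f∈ℛ zero) (InZinv-sum (λ i → f (suc i)) (λ i → f∈ℛ (suc i)))

    commonExponent : ∀ {n} (x : Vecℚ n) → (∀ i → InZinv d (x i)) → ∃[ e ] IntV (λ i → x i ℚ.* powℚ D e)
    commonExponent {zero}  x x∈ℛ = 0 , λ ()
    commonExponent {suc n} x x∈ℛ with x∈ℛ zero | commonExponent (λ i → x (suc i)) (λ i → x∈ℛ (suc i))
    ... | a , x₀·Dᵃ | e , rest = a ℕ.+ e , λ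
      { zero    → raiseExponent (x zero) a e x₀·Dᵃ
      ; (suc i) → raiseExponent′ (x (suc i)) e a (rest i) }

module IntegerAction {n : ℕ} where

  open import Data.Nat as ℕ using (zero; suc)
  open import Data.Integer as ℤ using (ℤ)
  import Data.Integer.Properties as ℤP
  open import Data.Rational as ℚ using (ℚ)
  import Data.Rational.Properties as ℚP
  open import Data.Fin using (Fin; zero; suc)
  open import Data.Fin.Properties using (_≟_)
  open import Data.Bool using (true; false)
  open import Relation.Nullary.Decidable using (⌊_⌋)
  open import Relation.Binary.PropositionalEquality as ≡ using (_≡_; refl; cong; cong₂; sym; trans; subst)
  open import Algebra.Bundles using (CommutativeRing; Ring)
  open import Algebra.Properties.CommutativeMonoid.Sum (CommutativeRing.+-commutativeMonoid ℚP.+-*-commutativeRing)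
    using (sum; sum-cong-≋; ∑-comm)
  open import Algebra.Properties.Semiring.Sum (CommutativeRing.semiring ℚP.+-*-commutativeRing)
    using (*-distribˡ-sum; *-distribʳ-sum)
  open import Algebra.Properties.CommutativeMonoid.Sum (CommutativeRing.+-commutativeMonoid ℤP.+-*-commutativeRing)
    using () renaming (sum to sumℤ)
  open Integrality
  open Determinant ℚP.+-*-commutativeRing using (sumFin≡sum)
  open MatrixRing ℤP.+-*-commutativeRing using (δ; _·ᴹ_; matrixRing)
  open MatrixRing ℚP.+-*-commutativeRing using (sum-δˡ) renaming (δ to δℚ)
  open Ring (matrixRing {n}) using () renaming (_≈_ to _≈ᴹ_; _*_ to _*ᴹ_; 1# to 1ᴹ)
  open import Algebra.Properties.Semiring.Exp (Ring.semiring (matrixRing {n})) using (_^_)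
  open ≡.≡-Reasoning

  act : Mat ℤ n → Vecℚ n → Vecℚ n
  act M = mulVec (λ i j → toℚ (M i j))

  act-sum : ∀ M x i → act M x i ≡ sum (λ j → toℚ (M i j) ℚ.* x j)
  act-sum M x i = sumFin≡sum (λ j → toℚ (M i j) ℚ.* x j)

  toℚ-sum : ∀ {m} (f : Fin m → ℤ) → toℚ (sumℤ f) ≡ sum (λ j → toℚ (f j))
  toℚ-sum {zero}  f = refl
  toℚ-sum {suc m} f = trans (toℚ-+ (f zero) (sumℤ (λ j → f (suc j)))) (cong (toℚ (f zero) ℚ.+_) (toℚ-sum (λ j → f (suc j))))

  act-cong : ∀ {M N} {x y : Vecℚ n} → M ≈ᴹ N → x ≋ y → act M x ≋ act N y
  act-cong {M} {N} {x} {y} M≈N x≋y i = begin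
    act M x i                             ≡⟨ act-sum M x i ⟩
    sum (λ j → toℚ (M i j) ℚ.* x j)       ≡⟨ sum-cong-≋ (λ j → cong₂ ℚ._*_ (cong toℚ (M≈N i j)) (x≋y j)) ⟩
    sum (λ j → toℚ (N i j) ℚ.* y j)       ≡⟨ act-sum N y i ⟨
    act N y i                             ∎

  act-*ᴹ : ∀ M N x → act (M *ᴹ N) x ≋ act M (act N x)
  act-*ᴹ M N x i = begin
    act (M *ᴹ N) x i
      ≡⟨ act-sum (M *ᴹ N) x i ⟩
    sum (λ k → toℚ (sumℤ (λ j → M i j ℤ.* N j k)) ℚ.* x k)
      ≡⟨ sum-cong-≋ (λ k → cong (ℚ._* x k) (trans (toℚ-sum (λ j → M i j ℤ.* N j k)) (sum-cong-≋ (λ j → toℚ-* (M i j) (N j k))))) ⟩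
    sum (λ k → sum (λ j → toℚ (M i j) ℚ.* toℚ (N j k)) ℚ.* x k)
      ≡⟨ sum-cong-≋ (λ k → *-distribʳ-sum (x k) (λ j → toℚ (M i j) ℚ.* toℚ (N j k))) ⟩
    sum (λ k → sum (λ j → toℚ (M i j) ℚ.* toℚ (N j k) ℚ.* x k))
      ≡⟨ ∑-comm (λ k j → toℚ (M i j) ℚ.* toℚ (N j k) ℚ.* x k) ⟩
    sum (λ j → sum (λ k → toℚ (M i j) ℚ.* toℚ (N j k) ℚ.* x k))
      ≡⟨ sum-cong-≋ (λ j → sum-cong-≋ (λ k → ℚP.*-assoc (toℚ (M i j)) (toℚ (N j k)) (x k))) ⟩
    sum (λ j → sum (λ k → toℚ (M i j) ℚ.* (toℚ (N j k) ℚ.* x k)))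
      ≡⟨ sum-cong-≋ (λ j → *-distribˡ-sum (toℚ (M i j)) (λ k → toℚ (N j k) ℚ.* x k)) ⟨
    sum (λ j → toℚ (M i j) ℚ.* sum (λ k → toℚ (N j k) ℚ.* x k))
      ≡⟨ sum-cong-≋ (λ j → cong (toℚ (M i j) ℚ.*_) (act-sum N x j)) ⟨
    sum (λ j → toℚ (M i j) ℚ.* act N x j)
      ≡⟨ act-sum M (act N x) i ⟨
    act M (act N x) i ∎

  act-·ᴹ : ∀ c M x → act (c ·ᴹ M) x ≋ λ i → toℚ c ℚ.* act M x i
  act-·ᴹ c M x i = begin
    act (c ·ᴹ M) x i                              ≡⟨ act-sum (c ·ᴹ M) x i ⟩
    sum (λ j → toℚ (c ℤ.* M i j) ℚ.* x j)
      ≡⟨ sum-cong-≋ (λ j → trans (cong (ℚ._* x j) (toℚ-* c (M i j))) (ℚP.*-assoc (toℚ c) (toℚ (M i j)) (x j))) ⟩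
    sum (λ j → toℚ c ℚ.* (toℚ (M i j) ℚ.* x j))   ≡⟨ *-distribˡ-sum (toℚ c) (λ j → toℚ (M i j) ℚ.* x j) ⟨
    toℚ c ℚ.* sum (λ j → toℚ (M i j) ℚ.* x j)     ≡⟨ cong (toℚ c ℚ.*_) (act-sum M x i) ⟨
    toℚ c ℚ.* act M x i                           ∎

  toℚ-δ : ∀ (i j : Fin n) → toℚ (δ i j) ≡ δℚ i j
  toℚ-δ i j with ⌊ i ≟ j ⌋
  ... | true  = refl
  ... | false = refl

  act-1ᴹ : ∀ x → act 1ᴹ x ≋ x
  act-1ᴹ x i = trans (act-sum 1ᴹ x i) (trans (sum-cong-≋ (λ j → cong (ℚ._* x j) (toℚ-δ i j))) (sum-δˡ i x))

  act-scale : ∀ M x s → act M (λ j → x j ℚ.* s) ≋ λ i → act M x i ℚ.* s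
  act-scale M x s i = begin
    act M (λ j → x j ℚ.* s) i                     ≡⟨ act-sum M (λ j → x j ℚ.* s) i ⟩
    sum (λ j → toℚ (M i j) ℚ.* (x j ℚ.* s))       ≡⟨ sum-cong-≋ (λ j → ℚP.*-assoc (toℚ (M i j)) (x j) s) ⟨
    sum (λ j → toℚ (M i j) ℚ.* x j ℚ.* s)         ≡⟨ *-distribʳ-sum s (λ j → toℚ (M i j) ℚ.* x j) ⟨
    sum (λ j → toℚ (M i j) ℚ.* x j) ℚ.* s         ≡⟨ cong (ℚ._* s) (act-sum M x i) ⟨
    act M x i ℚ.* s                               ∎

  IntV-act : ∀ M {x} → IntV x → IntV (act M x)
  IntV-act M {x} x-int i = subst IsInt (sym (act-sum M x i))
    (IsInt-sum (λ j → toℚ (M i j) ℚ.* x j) (λ j → IsInt-* (IsInt-toℚ (M i j)) (x-int j)))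

  module _ (A : Mat ℤ n) where

    powAct-cong : ∀ k {x y} → x ≋ y → powAct A k x ≋ powAct A k y
    powAct-cong zero    x≋y = x≋y
    powAct-cong (suc k) x≋y = act-cong {A} (λ i j → refl) (powAct-cong k x≋y)

    powAct-+ : ∀ k m x → powAct A k (powAct A m x) ≡ powAct A (k ℕ.+ m) x
    powAct-+ zero    m x = refl
    powAct-+ (suc k) m x = cong (act A) (powAct-+ k m x)

    powAct-^ : ∀ k x → powAct A k x ≋ act (A ^ k) x
    powAct-^ zero    x i = sym (act-1ᴹ x i)
    powAct-^ (suc k) x i = trans (act-cong {A} (λ i j → refl) (powAct-^ k x) i) (sym (act-*ᴹ A (A ^ k) x i))

    powAct-scale : ∀ k x s → powAct A k (λ j → x j ℚ.* s) ≋ λ i → powAct A k x i ℚ.* s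
    powAct-scale zero    x s i = refl
    powAct-scale (suc k) x s i = trans (act-cong {A} (λ i j → refl) (powAct-scale k x s) i) (act-scale A (powAct A k x) s i)

    IntV-powAct : ∀ k {x} → IntV x → IntV (powAct A k x)
    IntV-powAct zero    x-int = x-int
    IntV-powAct (suc k) x-int = IntV-act A (IntV-powAct k x-int)

module EndomorphismsOfG_A {n : ℕ} (A : Mat ℤ n) where

  open import Data.Nat as ℕ using (zero; suc)
  open import Data.Nat.Divisibility as ℕ∣ using (_∣_; ∣-trans; m∣m*n; n∣m*n)
  open import Data.Nat.Primality using (Prime)
  open import Data.Nat.Primality.Factorisation using (factorise)
  open import Data.Nat.ListAction using (product)
  open import Data.Integer as ℤ using (ℤ; +_; -[1+_])
  import Data.Integer.Properties as ℤP
  open import Data.Rational as ℚ using (ℚ)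
  import Data.Rational.Properties as ℚP
  open import Data.Fin using (Fin; zero; suc)
  open import Data.List using ([]; _∷_)
  open import Data.List.Relation.Unary.All using (All; []; _∷_)
  open import Data.Product using (∃-syntax; _,_; proj₁; proj₂)
  open import Data.Sum using (_⊎_; inj₁; inj₂)
  open import Function using (_∘_; _⇔_; mk⇔)
  open import Relation.Binary.PropositionalEquality as ≡ using (_≡_; _≢_; refl; cong; sym; trans; subst)
  open import Algebra.Bundles using (Ring; CommutativeRing)
  open Integrality
  open IntegerAction {n}
  open CayleyHamilton A using (leftQuasiInverse)
  open Determinant ℚP.+-*-commutativeRing using (sumFin≡sum)
  open MatrixRing ℚP.+-*-commutativeRing using (sum-δʳ)
  open import Algebra.Properties.CommutativeMonoid.Sum (CommutativeRing.+-commutativeMonoid ℚP.+-*-commutativeRing)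
    using (sum-cong-≋)
  open MatrixRing ℤP.+-*-commutativeRing using (δ; _·ᴹ_; matrixRing)
  open Ring (matrixRing {n}) using () renaming (_≈_ to _≈ᴹ_; _*_ to _*ᴹ_; 1# to 1ᴹ)
  open import Algebra.Properties.Semiring.Exp (Ring.semiring (matrixRing {n})) using (_^_)
  open import Algebra.Properties.Ring (CommutativeRing.ring ℚP.+-*-commutativeRing) using (-‿involutive)

  d : ℤ
  d = detℤ A

  D : ℚ
  D = toℚ d

  -- With Q·A = d·1, integrality of A (Aᵏ x) gives integrality of d·Aᵏ x = Aᵏ (d·x).
  preimage-bound : ∀ k x → IntV (powAct A k x) → IntV (λ i → x i ℚ.* powℚ D k)
  preimage-bound zero    x x-int i = subst IsInt (sym (ℚP.*-identityʳ (x i))) (x-int i)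
  preimage-bound (suc k) x Aᵏ⁺¹x-int i = subst IsInt (ℚP.*-assoc (x i) D (powℚ D k))
    (preimage-bound k (λ j → x j ℚ.* D) (λ j → subst IsInt (sym (powAct-scale A k x D j)) (dAᵏx-int j)) i)
    where
    Q = proj₁ leftQuasiInverse
    QA≈d = proj₂ leftQuasiInverse
    y = powAct A k x
    dAᵏx-int : IntV (λ j → y j ℚ.* D)
    dAᵏx-int j = subst IsInt (begin
      act Q (act A y) j           ≡⟨ act-*ᴹ Q A y j ⟨
      act (Q *ᴹ A) y j            ≡⟨ act-cong {Q *ᴹ A} QA≈d (λ _ → refl) j ⟩
      act (d ·ᴹ 1ᴹ) y j           ≡⟨ act-·ᴹ d 1ᴹ y j ⟩
      D ℚ.* act 1ᴹ y j            ≡⟨ cong (D ℚ.*_) (act-1ᴹ y j) ⟩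
      D ℚ.* y j                   ≡⟨ ℚP.*-comm D (y j) ⟩
      y j ℚ.* D                   ∎) (IntV-act Q Aᵏ⁺¹x-int j)
      where open ≡.≡-Reasoning

  G_A⊆ℛⁿ : ∀ x → InGA A x → ∀ i → InZinv d (x i)
  G_A⊆ℛⁿ x (+ m , y , x≋Aᵐy) i =
    IsInt⇒InZinv d (subst IsInt (sym (x≋Aᵐy i)) (IntV-powAct A m (λ j → IsInt-toℚ (y j)) i))
  G_A⊆ℛⁿ x (-[1+ m ] , y , Aᵐ⁺¹x≋y) i =
    suc m , preimage-bound (suc m) x (λ j → subst IsInt (sym (Aᵐ⁺¹x≋y j)) (IsInt-toℚ (y j))) i

  Absorbing : ℚ → Set
  Absorbing s = ∀ x → IntV (λ i → x i ℚ.* s) → ∃[ K ] IntV (powAct A K x)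

  absorbing-1 : Absorbing ℚ.1ℚ
  absorbing-1 x x-int = 0 , λ i → subst IsInt (ℚP.*-identityʳ (x i)) (x-int i)

  absorbing-* : ∀ {s t} → Absorbing s → Absorbing t → Absorbing (s ℚ.* t)
  absorbing-* {s} {t} absorbs-s absorbs-t x xst-int with absorbs-s (λ i → x i ℚ.* t) xts-int
    where
    xts-int : IntV (λ i → x i ℚ.* t ℚ.* s)
    xts-int i = subst IsInt (trans (cong (x i ℚ.*_) (ℚP.*-comm s t)) (sym (ℚP.*-assoc (x i) t s))) (xst-int i)
  ... | K , AᴷxT-int with absorbs-t (powAct A K x) (λ i → subst IsInt (powAct-scale A K x t i) (AᴷxT-int i))
  ...   | K′ , Aᴷ′Aᴷx-int = K′ ℕ.+ K , subst IntV (powAct-+ A K′ K x) Aᴷ′Aᴷx-int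

  absorbing-neg : ∀ {s} → Absorbing s → Absorbing (ℚ.- s)
  absorbing-neg {s} absorbs-s x x·-s-int = absorbs-s x λ i → subst IsInt
    (trans (cong ℚ.-_ (sym (ℚP.neg-distribʳ-* (x i) s))) (-‿involutive (x i ℚ.* s))) (IsInt-neg (x·-s-int i))

  absorbing-pow : ∀ {s} m → Absorbing s → Absorbing (powℚ s m)
  absorbing-pow zero    absorbs-s = absorbing-1
  absorbing-pow (suc m) absorbs-s = absorbing-* absorbs-s (absorbing-pow m absorbs-s)

  -- Aⁿ = p·N sends x to N (p·x).
  absorbing-nilpotent : ∀ p → ∃[ N ] A ^ n ≈ᴹ + p ·ᴹ N → Absorbing (toℚ (+ p))
  absorbing-nilpotent p (N , Aⁿ≈pN) x xp-int = n , λ i → subst IsInt (sym (begin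
    powAct A n x i                   ≡⟨ powAct-^ A n x i ⟩
    act (A ^ n) x i                  ≡⟨ act-cong {A ^ n} Aⁿ≈pN (λ _ → refl) i ⟩
    act (+ p ·ᴹ N) x i               ≡⟨ act-·ᴹ (+ p) N x i ⟩
    toℚ (+ p) ℚ.* act N x i          ≡⟨ ℚP.*-comm (toℚ (+ p)) (act N x i) ⟩
    act N x i ℚ.* toℚ (+ p)          ≡⟨ act-scale N x (toℚ (+ p)) i ⟨
    act N (λ j → x j ℚ.* toℚ (+ p)) i ∎)) (IntV-act N xp-int i)
    where open ≡.≡-Reasoning

  NilpotentModuloPrimesOf : ℤ → Set
  NilpotentModuloPrimesOf d′ = ∀ p → Prime p → p ∣ ℤ.∣ d′ ∣ → ∃[ N ] A ^ n ≈ᴹ + p ·ᴹ N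

  absorbing-primeProduct : ∀ {g} → (∀ p → Prime p → p ∣ g → Absorbing (toℚ (+ p))) →
    ∀ ps → All Prime ps → product ps ∣ g → Absorbing (toℚ (+ product ps))
  absorbing-primeProduct absorbs []       []        _     = absorbing-1
  absorbing-primeProduct absorbs (p ∷ ps) (p′ ∷ ps′) ∏∣g = subst Absorbing
    (trans (sym (toℚ-* (+ p) (+ product ps))) (cong toℚ (sym (ℤP.pos-* p (product ps)))))
    (absorbing-* (absorbs p p′ (∣-trans (m∣m*n (product ps)) ∏∣g))
                 (absorbing-primeProduct absorbs ps ps′ (∣-trans (n∣m*n p) ∏∣g)))

  absorbing-det : d ≢ + 0 → NilpotentModuloPrimesOf d → Absorbing D
  absorbing-det d≢0 nilpotent with factorise ℤ.∣ d ∣ {{ℕ.≢-nonZero (d≢0 ∘ ℤP.∣i∣≡0⇒i≡0)}}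
  ... | record { factors = ps ; isFactorisation = ∣d∣≡∏ ; factorsPrime = ps-prime } = absorbing-± (ℤP.+∣i∣≡i⊎+∣i∣≡-i d)
    where
    absorbs-∣d∣ : Absorbing (toℚ (+ ℤ.∣ d ∣))
    absorbs-∣d∣ = subst (λ g → Absorbing (toℚ (+ g))) (sym ∣d∣≡∏)
      (absorbing-primeProduct (λ p p-prime p∣d → absorbing-nilpotent p (nilpotent p p-prime p∣d)) ps ps-prime
        (subst (product ps ∣_) (sym ∣d∣≡∏) ℕ∣.∣-refl))
    absorbing-± : + ℤ.∣ d ∣ ≡ d ⊎ + ℤ.∣ d ∣ ≡ ℤ.- d → Absorbing D
    absorbing-± (inj₁ ∣d∣≡d)  = subst (λ z → Absorbing (toℚ z)) ∣d∣≡d absorbs-∣d∣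
    absorbing-± (inj₂ ∣d∣≡-d) = subst Absorbing (trans (cong ℚ.-_ (trans (cong toℚ ∣d∣≡-d) (toℚ-neg d))) (-‿involutive D))
      (absorbing-neg absorbs-∣d∣)

  IntV-powAct⇒G_A : ∀ K x → IntV (powAct A (suc K) x) → InGA A x
  IntV-powAct⇒G_A K x Aᴷ⁺¹x-int = -[1+ K ] , (λ i → proj₁ (Aᴷ⁺¹x-int i)) , (λ i → proj₂ (Aᴷ⁺¹x-int i))

  ℛⁿ⊆G_A : d ≢ + 0 → NilpotentModuloPrimesOf d → ∀ x → (∀ i → InZinv d (x i)) → InGA A x
  ℛⁿ⊆G_A d≢0 nilpotent x x∈ℛⁿ with commonExponent d x x∈ℛⁿ
  ... | e , xDᵉ-int with absorbing-pow e (absorbing-det d≢0 nilpotent) x xDᵉ-int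
  ...   | K , Aᴷx-int = IntV-powAct⇒G_A K x (IntV-act A Aᴷx-int)

  basis : Fin n → Vecℚ n
  basis j i = toℚ (δ i j)

  basis∈G_A : ∀ j → InGA A (basis j)
  basis∈G_A j = + 0 , (λ i → δ i j) , (λ i → refl)

  mulVec-basis : ∀ (T : Mat ℚ n) i j → mulVec T (basis j) i ≡ T i j
  mulVec-basis T i j = trans (sumFin≡sum (λ l → T i l ℚ.* basis j l))
    (trans (sum-cong-≋ (λ l → cong (T i l ℚ.*_) (toℚ-δ l j))) (sum-δʳ j (T i)))

  End⇒Mℛ : ∀ T → InEnd A T → InMR d T
  End⇒Mℛ T T∈End i j = subst (InZinv d) (mulVec-basis T i j) (G_A⊆ℛⁿ (mulVec T (basis j)) (T∈End (basis j) (basis∈G_A j)) i)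

  Mℛ⇒End : d ≢ + 0 → NilpotentModuloPrimesOf d → ∀ T → InMR d T → InEnd A T
  Mℛ⇒End d≢0 nilpotent T T∈Mℛ x x∈G_A = ℛⁿ⊆G_A d≢0 nilpotent (mulVec T x) λ i →
    subst (InZinv d) (sym (sumFin≡sum (λ j → T i j ℚ.* x j)))
      (InZinv-sum d (λ j → T i j ℚ.* x j) (λ j → InZinv-* d (T i j) (x j) (T∈Mℛ i j) (G_A⊆ℛⁿ x x∈G_A j)))

  End⇔Mℛ : d ≢ + 0 → NilpotentModuloPrimesOf d → ∀ T → InEnd A T ⇔ InMR d T
  End⇔Mℛ d≢0 nilpotent T = mk⇔ (End⇒Mℛ T) (Mℛ⇒End d≢0 nilpotent T)

module Units where

  open import Data.Nat as ℕ using (ℕ; zero; suc)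
  open import Data.Nat.Divisibility using (_∣_; m∣m*n)
  open import Data.Nat.Primality using (Prime)
  open import Data.Nat.Primality.Factorisation using (factorise)
  open import Data.Integer as ℤ using (ℤ; +_; -[1+_])
  import Data.Integer.Properties as ℤP
  open import Data.Rational as ℚ using (ℚ)
  import Data.Rational.Properties as ℚP
  open import Data.List using ([]; _∷_)
  open import Data.List.Relation.Unary.All using (_∷_)
  open import Data.Product using (_,_)
  open import Data.Empty using (⊥-elim)
  open import Function using (_∘_)
  open import Relation.Nullary using (¬_)
  open import Relation.Binary.PropositionalEquality using (_≡_; _≢_; refl; cong; sym; trans; subst)
  open Integrality

  noPrimeDivisor⇒unit : ∀ z → z ≢ + 0 → (∀ p → Prime p → ¬ p ∣ ℤ.∣ z ∣) → ℤ.∣ z ∣ ≡ 1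
  noPrimeDivisor⇒unit z z≢0 noPrime with factorise ℤ.∣ z ∣ {{ℕ.≢-nonZero (z≢0 ∘ ℤP.∣i∣≡0⇒i≡0)}}
  ... | record { factors = []     ; isFactorisation = ∣z∣≡1 } = ∣z∣≡1
  ... | record { factors = p ∷ ps ; isFactorisation = ∣z∣≡∏ ; factorsPrime = p-prime ∷ _ } =
    ⊥-elim (noPrime p p-prime (subst (p ∣_) (sym ∣z∣≡∏) (m∣m*n _)))

  unit-square : ∀ z → ℤ.∣ z ∣ ≡ 1 → toℚ z ℚ.* toℚ z ≡ ℚ.1ℚ
  unit-square (+ 1)      refl = refl
  unit-square -[1+ zero ] refl = refl

  InZinv-unit : ∀ z → toℚ z ℚ.* toℚ z ≡ ℚ.1ℚ → ∀ {q} → InZinv z q → IsInt q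
  InZinv-unit z z²≡1 {q} (m , q·zᵐ-int) = cancel m q q·zᵐ-int
    where
    cancel : ∀ m q → IsInt (q ℚ.* powℚ (toℚ z) m) → IsInt q
    cancel zero    q q·1-int    = subst IsInt (ℚP.*-identityʳ q) q·1-int
    cancel (suc m) q q·zᵐ⁺¹-int = subst IsInt
      (trans (ℚP.*-assoc q (toℚ z) (toℚ z)) (trans (cong (q ℚ.*_) z²≡1) (ℚP.*-identityʳ q)))
      (IsInt-* (cancel m (q ℚ.* toℚ z) (subst IsInt (sym (ℚP.*-assoc q (toℚ z) (powℚ (toℚ z) m))) q·zᵐ⁺¹-int)) (IsInt-toℚ z))

module PrimeConditions {n : ℕ} (A : Mat ℤ n) where

  open import Data.Nat.Divisibility using (_∣?_)
  open import Data.Product using (_,_)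
  open import Data.Empty using (⊥-elim)
  open import Function using (_⇔_; mk⇔)
  open import Relation.Nullary using (yes; no)
  open import Relation.Binary.PropositionalEquality using (_≡_; _≢_)
  open import Data.Integer as ℤ using (ℤ; +_)
  open import Data.Rational using (ℚ)
  open Integrality
  open Units
  open EndomorphismsOfG_A A using (NilpotentModuloPrimesOf)

  -- A coefficient not divisible by p would put p into 𝒫'.
  𝒫'-empty⇒nilpotent : 𝒫'-empty A → NilpotentModuloPrimesOf (detℤ A)
  𝒫'-empty⇒nilpotent 𝒫'≡∅ p p-prime p∣d = CayleyHamilton.nilpotentModulo A p h≡xⁿ
    where
    h≡xⁿ : CongXPowMod (charPoly A) n p
    h≡xⁿ i with p ∣? ℤ.∣ coeff (charPoly A) i ℤ.- xPow n i ∣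
    ... | yes p∣hᵢ = p∣hᵢ
    ... | no  p∤hᵢ = ⊥-elim (𝒫'≡∅ p ((p-prime , p∣d) , λ h≡xⁿ → p∤hᵢ (h≡xⁿ i)))

  𝒫-empty⇒unit : detℤ A ≢ + 0 → 𝒫-empty A → ℤ.∣ detℤ A ∣ ≡ 1
  𝒫-empty⇒unit d≢0 𝒫≡∅ = noPrimeDivisor⇒unit (detℤ A) d≢0 (λ p p-prime p∣d → 𝒫≡∅ p (p-prime , p∣d))

  𝒫-empty⇒nilpotent : 𝒫-empty A → NilpotentModuloPrimesOf (detℤ A)
  𝒫-empty⇒nilpotent 𝒫≡∅ p p-prime p∣d = ⊥-elim (𝒫≡∅ p (p-prime , p∣d))

  Mℛ⇔Mℤ : ℤ.∣ detℤ A ∣ ≡ 1 → (T : Mat ℚ n) → InMR (detℤ A) T ⇔ InMℤ T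
  Mℛ⇔Mℤ ∣d∣≡1 T = mk⇔ (λ T∈Mℛ i j → InZinv-unit (detℤ A) (unit-square (detℤ A) ∣d∣≡1) (T∈Mℛ i j))
                     (λ T∈Mℤ i j → IsInt⇒InZinv (detℤ A) (T∈Mℤ i j))

lemma3p2 : (n : ℕ) (A : Mat ℤ n) → detℤ A ≢ + 0 →
    ((𝒫-empty A → (T : Mat ℚ n) → InEnd A T ⇔ InMℤ T)
    × (𝒫'-empty A → ¬ InGLℤ A → (T : Mat ℚ n) → InEnd A T ⇔ InMR (detℤ A) T))
lemma3p2 n A d≢0 = part₁ , part₂
  where
  open EndomorphismsOfG_A A using (End⇔Mℛ)
  open PrimeConditions A
  part₁ : 𝒫-empty A → (T : Mat ℚ n) → InEnd A T ⇔ InMℤ T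
  part₁ 𝒫≡∅ T = Mℛ⇔Mℤ (𝒫-empty⇒unit d≢0 𝒫≡∅) T ⇔-∘ End⇔Mℛ d≢0 (𝒫-empty⇒nilpotent 𝒫≡∅) T
  -- The conclusion holds for every non-singular A.
  part₂ : 𝒫'-empty A → ¬ InGLℤ A → (T : Mat ℚ n) → InEnd A T ⇔ InMR (detℤ A) T
  part₂ 𝒫'≡∅ _ = End⇔Mℛ d≢0 (𝒫'-empty⇒nilpotent 𝒫'≡∅)
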